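{- Let $S$ be a finite non-empty set and let $\mathcal{C}$ be the set of maximal chains in the lattice of partitions of $S$ (ordered by refinement, finer partitions below coarser ones). For each CD basis $F$ of the lattice of subsets of $S$, let $F'$ be the set of non-empty, non-singleton members of $F$, let $\Lambda_F$ be the set of linear extensions of the set-containment order on $F'$ (each viewed as the set $F'$ equipped with a linear order extending $\subseteq$), and let $\Lambda$ be the union of the sets $\Lambda_F$ over all CD bases $F$ of the lattice of subsets of $S$. For a maximal chain $K$ of partitions $\Pi_0<\Pi_1<\dots$ of $S$ and a non-singleton set $A$ appearing as a class of some member of $K$, let the index of first appearance of $A$ in $K$ be $\min\{k : 0<k,\ A \text{ is a class of } \Pi_k\}$. Then the map which associates to each maximal chain $K\in\mathcal{C}$ the set of non-singleton classes of the various members of $K$, linearly ordered according to their indices of first appearance in $K$, is a bijection from $\mathcal{C}$ to $\Lambda$.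
   Context: A family $F$ of subsets of $S$ is CD-independent if any two members $X,Y\in F$ are either comparable ($X\subseteq Y$ or $Y\subseteq X$) or disjoint ($X\cap Y=\emptyset$). A CD basis of the lattice of subsets of $S$ is a maximal (with respect to inclusion) CD-independent family of subsets of $S$. Distinct sets have distinct indices of first appearance in a maximal chain, so the non-singleton classes occurring in the chain are linearly ordered by this index. -}

module Defs where

open import Data.Nat using (ℕ; zero; suc; _≤_; _≤?_)
open import Data.Bool using (Bool; true; false; _∧_; not)
import Data.Bool.Properties as BoolP
open import Data.Fin using (Fin)
open import Data.Fin.Subset using (Subset; _∈_; _⊆_; _∩_; ∣_∣; Nonempty; Empty)
open import Data.Vec using (Vec; []; _∷_)
open import Data.Vec.Properties using (≡-dec)
open import Data.List using (List; []; _∷_; _++_; map; filter; [_])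
open import Data.Bool.ListAction using (any)
open import Data.List.Membership.Propositional using () renaming (_∈_ to _∈ₗ_)
open import Data.List.Relation.Unary.Any using (Any)
open import Data.List.Relation.Unary.Linked using (Linked)
open import Data.List.Relation.Unary.Unique.Propositional using (Unique)
open import Data.List.Relation.Binary.Sublist.Propositional using () renaming (_⊆_ to _⊑_)
open import Data.Product using (Σ; ∃; _×_; _,_)
open import Data.Sum using (_⊎_)
open import Relation.Nullary using (¬_; does)
open import Relation.Binary.PropositionalEquality using (_≡_; _≢_)

_≟ˢ_ : ∀ {n} (A B : Subset n) → Relation.Nullary.Dec (A ≡ B)
_≟ˢ_ = ≡-dec BoolP._≟_

allSubsets : ∀ n → List (Subset n)
allSubsets zero = [ [] ]
allSubsets (suc n) = map (true ∷_) (allSubsets n) ++ map (false ∷_) (allSubsets n)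

NonTrivial : ∀ {n} → Subset n → Set
NonTrivial A = 2 ≤ ∣ A ∣

nonTrivial? : ∀ {n} → Subset n → Bool
nonTrivial? A = does (2 ≤? ∣ A ∣)

record Partition (n : ℕ) : Set where
  field
    isBlock  : Subset n → Bool
    nonempty : ∀ A → isBlock A ≡ true → Nonempty A
    disjoint : ∀ A B → isBlock A ≡ true → isBlock B ≡ true → A ≢ B → Empty (A ∩ B)
    cover    : ∀ x → ∃ λ A → isBlock A ≡ true × x ∈ A
open Partition public

IsClass : ∀ {n} → Partition n → Subset n → Set
IsClass Π A = isBlock Π A ≡ true

_≈ₚ_ : ∀ {n} → Partition n → Partition n → Set
P ≈ₚ Q = ∀ A → isBlock P A ≡ isBlock Q A

_≤ₚ_ : ∀ {n} → Partition n → Partition n → Set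
P ≤ₚ Q = ∀ A → IsClass P A → ∃ λ B → IsClass Q B × A ⊆ B

_<ₚ_ : ∀ {n} → Partition n → Partition n → Set
P <ₚ Q = P ≤ₚ Q × ¬ (P ≈ₚ Q)

IsMaximalChain : ∀ {n} → List (Partition n) → Set
IsMaximalChain {n} K =
  Linked _<ₚ_ K ×
  (∀ (Q : Partition n) → (∀ P → P ∈ₗ K → Q ≤ₚ P ⊎ P ≤ₚ Q) → Any (Q ≈ₚ_) K)

-- The map: non-singleton classes of the members of K, listed in order
-- of their index of first appearance (index 0, i.e. Π₀, is excluded).

newClasses : ∀ {n} → List (Subset n) → Partition n → List (Subset n)
newClasses {n} seen Π =
  filter (λ A → T? (isBlock Π A ∧ nonTrivial? A ∧ not (any (λ B → does (A ≟ˢ B)) seen)))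
         (allSubsets n)
  where open import Data.Bool using (T?)

classesFrom : ∀ {n} → List (Subset n) → List (Partition n) → List (Subset n)
classesFrom seen [] = []
classesFrom seen (Π ∷ K) = newClasses seen Π ++ classesFrom (seen ++ newClasses seen Π) K

chainClasses : ∀ {n} → List (Partition n) → List (Subset n)
chainClasses [] = []
chainClasses (Π₀ ∷ K) = classesFrom [] K

CDIndependent : ∀ {n} → (Subset n → Bool) → Set
CDIndependent F = ∀ X Y → F X ≡ true → F Y ≡ true →
  X ⊆ Y ⊎ Y ⊆ X ⊎ Empty (X ∩ Y)

IsCDBasis : ∀ {n} → (Subset n → Bool) → Set
IsCDBasis {n} F = CDIndependent F ×
  (∀ (G : Subset n → Bool) → CDIndependent G → (∀ X → F X ≡ true → G X ≡ true) →
     ∀ X → G X ≡ true → F X ≡ true)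

-- A linear extension of ⊆ on F' = {X ∈ F | X non-empty, non-singleton},
-- represented as the duplicate-free list of the elements of F' in
-- increasing order.
IsLinearExtension : ∀ {n} → (Subset n → Bool) → List (Subset n) → Set
IsLinearExtension F L =
  Unique L ×
  (∀ A → (A ∈ₗ L → F A ≡ true × NonTrivial A) × (F A ≡ true × NonTrivial A → A ∈ₗ L)) ×
  (∀ A B → A ∈ₗ L → B ∈ₗ L → A ⊆ B → A ≢ B → (A ∷ B ∷ []) ⊑ L)

InΛ : ∀ {n} → List (Subset n) → Set
InΛ {n} L = Σ (Subset n → Bool) λ F → IsCDBasis F × IsLinearExtension F L

-- A maximal chain of partitions climbs from the discrete partition to the one-block partition by
-- covering steps, each merging two classes A₁, A₂ into a new class B = A₁ ∪ A₂, and each partition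
-- of the chain is determined by its predecessor and B.  So the chain is recorded by the list of
-- created classes, and this list is exactly the list of its non-singleton classes by first
-- appearance.  Together with the sets of size at most one, the created classes are pairwise
-- comparable or disjoint, every set compatible with all of them was created (it lies inside the
-- top class), and a class is created only after its subsets: they form a linear extension of the
-- non-trivial part of a CD basis.  Conversely, every non-trivial member B of a CD basis is the
-- disjoint union of two maximal members strictly below it; following a linear extension and
-- merging these two sets at each step rebuilds a maximal chain.

module Submission where

open import Defs
open import Data.Nat using (ℕ; zero; suc; _≤_; z≤n; s≤s; _≤?_; _+_)
import Data.Nat.Properties as ℕ
open import Data.Bool using (Bool; true; false; _∧_; _∨_; not; T?) renaming (_≟_ to _≟ᵇ_)
open import Data.Bool.Properties using (¬-not)
open import Data.Fin using (Fin; zero; suc)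
import Data.Fin.Properties as Fin
open import Data.Fin.Subset
  using (Subset; _∈_; _∉_; _⊆_; _∩_; _∪_; ⊤; ⁅_⁆; ∣_∣; Nonempty; Empty)
open import Data.Fin.Subset.Properties
open import Data.Vec.Base using ([]; _∷_; here; there)
open import Data.Vec.Properties using (∷-injectiveʳ)
open import Data.Product using (∃; ∃₂; _×_; _,_; proj₁; proj₂)
open import Data.Sum using (_⊎_; inj₁; inj₂; [_,_]′; swap; map₂)
open import Data.List using (List; []; _∷_; [_]; _++_; map; filter)
open import Data.List.Properties using (++-assoc; ++-identityʳ; filter-++)
open import Data.Bool.ListAction using (any)
open import Data.List.Membership.Propositional using (find) renaming (_∈_ to _∈ₗ_)
open import Data.List.Membership.Propositional.Properties using (∈-++⁺ˡ; ∈-++⁺ʳ; ∈-++⁻)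
open import Data.List.Relation.Unary.Any using (Any; here; there)
open import Data.List.Relation.Unary.All using (All; []; _∷_)
import Data.List.Relation.Unary.All as All
import Data.List.Relation.Unary.All.Properties as All
open import Data.List.Relation.Unary.AllPairs using (AllPairs; []; _∷_)
open import Data.List.Relation.Unary.Linked using (Linked; []; [-]; _∷_)
open import Data.List.Relation.Unary.Linked.Properties using (Linked⇒AllPairs)
open import Data.List.Relation.Binary.Pointwise using (Pointwise; []; _∷_)
open import Data.List.Relation.Unary.Unique.Propositional using (Unique)
import Data.List.Relation.Unary.Unique.Propositional.Properties as Unique
open import Data.List.Relation.Binary.Sublist.Propositional
  using (_∷_; _∷ʳ_; from∈; to∈) renaming (_⊆_ to _⊑_; ⊆-refl to ⊑-refl)
import Data.List.Relation.Binary.Sublist.Propositional.Properties as Sublist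
open import Data.Empty using (⊥; ⊥-elim)
open import Relation.Nullary using (¬_; Dec; yes; no; does; ¬?)
open import Relation.Nullary.Decidable using (dec-true; _×-dec_; _⊎-dec_)
open import Relation.Unary using (Decidable)
open import Function using (case_of_)
open import Relation.Binary.PropositionalEquality using (_≡_; _≢_; refl; sym; trans; cong; cong₂; subst)

does-true⇒ : ∀ {p} {P : Set p} (P? : Dec P) → does P? ≡ true → P
does-true⇒ (yes p) _ = p

∧-true⁻ : {a b : Bool} → a ∧ b ≡ true → a ≡ true × b ≡ true
∧-true⁻ {true} {true} _ = refl , refl

not-true⁻ : {a : Bool} → not a ≡ true → a ≡ false
not-true⁻ {false} _ = refl

≡-true⇔true : {a b : Bool} → (a ≡ true → b ≡ true) → (b ≡ true → a ≡ true) → a ≡ b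
≡-true⇔true {false} {false} _ _ = refl
≡-true⇔true {false} {true} _ b⇒a = b⇒a refl
≡-true⇔true {true} {false} a⇒b _ = sym (a⇒b refl)
≡-true⇔true {true} {true} _ _ = refl

module _ {n : ℕ} where

  ∈⇒1≤∣p∣ : ∀ {x} {p : Subset n} → x ∈ p → 1 ≤ ∣ p ∣
  ∈⇒1≤∣p∣ {x} {p} x∈p = subst (_≤ ∣ p ∣) (∣⁅x⁆∣≡1 x) (p⊆q⇒∣p∣≤∣q∣ ⁅x⁆⊆p)
    where
    ⁅x⁆⊆p : ⁅ x ⁆ ⊆ p
    ⁅x⁆⊆p y∈⁅x⁆ = subst (_∈ p) (sym (x∈⁅y⁆⇒x≡y x y∈⁅x⁆)) x∈p

  distinct⇒NonTrivial : ∀ {x y} {p : Subset n} → x ∈ p → y ∈ p → x ≢ y → NonTrivial p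
  distinct⇒NonTrivial x∈p y∈p x≢y =
    ℕ.≤-trans (s≤s (∈⇒1≤∣p∣ (x∈p∧x≢y⇒x∈p-y y∈p (λ y≡x → x≢y (sym y≡x))))) (x∈p⇒∣p-x∣<∣p∣ x∈p)

1≤∣p∣⇒Nonempty : ∀ {n} (p : Subset n) → 1 ≤ ∣ p ∣ → Nonempty p
1≤∣p∣⇒Nonempty (true ∷ p) _ = zero , here
1≤∣p∣⇒Nonempty (false ∷ p) 1≤∣p∣ with 1≤∣p∣⇒Nonempty p 1≤∣p∣
... | x , x∈p = suc x , there x∈p

NonTrivial⇒distinct : ∀ {n} (p : Subset n) → NonTrivial p → ∃₂ λ x y → x ∈ p × y ∈ p × x ≢ y
NonTrivial⇒distinct (true ∷ p) (s≤s 1≤∣p∣) with 1≤∣p∣⇒Nonempty p 1≤∣p∣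
... | y , y∈p = zero , suc y , here , there y∈p , λ ()
NonTrivial⇒distinct (false ∷ p) 2≤∣p∣ with NonTrivial⇒distinct p 2≤∣p∣
... | x , y , x∈p , y∈p , x≢y = suc x , suc y , there x∈p , there y∈p , λ e → x≢y (Fin.suc-injective e)

module _ {n : ℕ} where

  NonTrivial⇒Nonempty : {p : Subset n} → NonTrivial p → Nonempty p
  NonTrivial⇒Nonempty {p} nt with NonTrivial⇒distinct p nt
  ... | x , _ , x∈p , _ = x , x∈p

  NonTrivial-mono : {p q : Subset n} → p ⊆ q → NonTrivial p → NonTrivial q
  NonTrivial-mono {p} p⊆q nt with NonTrivial⇒distinct p nt
  ... | x , y , x∈p , y∈p , x≢y = distinct⇒NonTrivial (p⊆q x∈p) (p⊆q y∈p) x≢y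

  ¬NonTrivial⇒≡ : ∀ {p : Subset n} {x y} → ¬ NonTrivial p → x ∈ p → y ∈ p → x ≡ y
  ¬NonTrivial⇒≡ {x = x} {y} ¬nt x∈p y∈p with x Fin.≟ y
  ... | yes x≡y = x≡y
  ... | no x≢y = ⊥-elim (¬nt (distinct⇒NonTrivial x∈p y∈p x≢y))

  ∣p∣≡1⇒¬NonTrivial : {p : Subset n} → ∣ p ∣ ≡ 1 → ¬ NonTrivial p
  ∣p∣≡1⇒¬NonTrivial ∣p∣≡1 nt with subst (2 ≤_) ∣p∣≡1 nt
  ... | s≤s ()

  ¬NonTrivial-⁅x⁆ : (x : Fin n) → ¬ NonTrivial ⁅ x ⁆
  ¬NonTrivial-⁅x⁆ x = ∣p∣≡1⇒¬NonTrivial {p = ⁅ x ⁆} (∣⁅x⁆∣≡1 x)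

  Nonempty⇒∣p∣≡1⊎NonTrivial : {p : Subset n} → Nonempty p → ∣ p ∣ ≡ 1 ⊎ NonTrivial p
  Nonempty⇒∣p∣≡1⊎NonTrivial {p} (_ , x∈p) with ∣ p ∣ | ∈⇒1≤∣p∣ x∈p
  ... | suc zero    | _ = inj₁ refl
  ... | suc (suc k) | _ = inj₂ (s≤s (s≤s z≤n))

  ⊆∧≢⇒∃∉ : {p q : Subset n} → q ⊆ p → p ≢ q → ∃ λ x → x ∈ p × x ∉ q
  ⊆∧≢⇒∃∉ {p} {q} q⊆p p≢q with Fin.any? (λ x → x ∈? p ×-dec ¬? (x ∈? q))
  ... | yes witness = witness
  ... | no none = ⊥-elim (p≢q (⊆-antisym p⊆q q⊆p))
    where
    p⊆q : p ⊆ q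
    p⊆q {x} x∈p with x ∈? q
    ... | yes x∈q = x∈q
    ... | no x∉q = ⊥-elim (none (x , x∈p , x∉q))

  Maximal : (Subset n → Set) → Subset n → Set
  Maximal P Y = P Y × (∀ Z → P Z → Y ⊆ Z → Z ≡ Y)

  ⊆-maximal : {P : Subset n → Set} → Decidable P → ∀ {X} → P X → ∃ λ Y → X ⊆ Y × Maximal P Y
  ⊆-maximal {P} P? {X₀} PX₀ = go n X₀ PX₀ (ℕ.m≤n+m n ∣ X₀ ∣)
    where
    -- k is fuel: ∣ X ∣ strictly grows along ⊂ and never exceeds n.
    go : ∀ k X → P X → n ≤ ∣ X ∣ + k → ∃ λ Y → X ⊆ Y × Maximal P Y
    go k X PX bound with anySubset? (λ Z → P? Z ×-dec (X ⊂? Z))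
    ... | no noLarger = X , ⊆-refl , PX , maximal
      where
      maximal : ∀ Z → P Z → X ⊆ Z → Z ≡ X
      maximal Z PZ X⊆Z with Z ≟ˢ X
      ... | yes Z≡X = Z≡X
      ... | no Z≢X = ⊥-elim (noLarger (Z , PZ , X⊆Z , ⊆∧≢⇒∃∉ X⊆Z Z≢X))
    go zero X PX bound | yes (Z , PZ , X⊂Z) = ⊥-elim (ℕ.<⇒≱ (p⊂q⇒∣p∣<∣q∣ X⊂Z)
      (ℕ.≤-trans (∣p∣≤n Z) (subst (n ≤_) (ℕ.+-identityʳ ∣ X ∣) bound)))
    go (suc k) X PX bound | yes (Z , PZ , X⊂Z) with go k Z PZ
      (ℕ.≤-trans (subst (n ≤_) (ℕ.+-suc ∣ X ∣ k) bound) (ℕ.+-monoˡ-≤ k (p⊂q⇒∣p∣<∣q∣ X⊂Z)))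
    ... | Y , Z⊆Y , maxY = Y , (λ x∈X → Z⊆Y (proj₁ X⊂Z x∈X)) , maxY

  ¬NonTrivial⇒⊆ : {p q : Subset n} {x : Fin n} → ¬ NonTrivial p → x ∈ p → x ∈ q → p ⊆ q
  ¬NonTrivial⇒⊆ {q = q} ¬nt x∈p x∈q y∈p = subst (_∈ q) (¬NonTrivial⇒≡ ¬nt x∈p y∈p) x∈q

module _ {n : ℕ} where

  Empty∩⇒∉ : {p q : Subset n} {x : Fin n} → Empty (p ∩ q) → x ∈ p → x ∉ q
  Empty∩⇒∉ empty x∈p x∈q = empty (_ , x∈p∩q⁺ (x∈p , x∈q))

  ∉⇒Empty∩ : {p q : Subset n} → (∀ {x} → x ∈ p → x ∉ q) → Empty (p ∩ q)
  ∉⇒Empty∩ {p} {q} apart (x , x∈p∩q) with x∈p∩q⁻ p q x∈p∩q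
  ... | x∈p , x∈q = apart x∈p x∈q

  Compatible : Subset n → Subset n → Set
  Compatible X Y = X ⊆ Y ⊎ Y ⊆ X ⊎ Empty (X ∩ Y)

  Compatible-sym : {X Y : Subset n} → Compatible X Y → Compatible Y X
  Compatible-sym (inj₁ X⊆Y) = inj₂ (inj₁ X⊆Y)
  Compatible-sym (inj₂ (inj₁ Y⊆X)) = inj₁ Y⊆X
  Compatible-sym (inj₂ (inj₂ empty)) = inj₂ (inj₂ (∉⇒Empty∩ λ y∈Y y∈X → Empty∩⇒∉ empty y∈X y∈Y))

  ¬NonTrivial⇒Compatible : {X Y : Subset n} → ¬ NonTrivial X → Compatible X Y
  ¬NonTrivial⇒Compatible {X} {Y} ¬nt with nonempty? (X ∩ Y)
  ... | no empty = inj₂ (inj₂ empty)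
  ... | yes (x , x∈X∩Y) with x∈p∩q⁻ X Y x∈X∩Y
  ...   | x∈X , x∈Y = inj₁ (¬NonTrivial⇒⊆ ¬nt x∈X x∈Y)

⊆∪∧Empty∩⇒⊆ : ∀ {n} {X A A′ : Subset n} → X ⊆ A ∪ A′ → Empty (X ∩ A′) → X ⊆ A
⊆∪∧Empty∩⇒⊆ {A = A} {A′} X⊆A∪A′ empty x∈X with x∈p∪q⁻ A A′ (X⊆A∪A′ x∈X)
... | inj₁ x∈A = x∈A
... | inj₂ x∈A′ = ⊥-elim (Empty∩⇒∉ empty x∈X x∈A′)

⊆∪-Compatible : ∀ {n} {X A₁ A₂ : Subset n} → X ⊆ A₁ ∪ A₂ → Nonempty X → Compatible X A₁ → Compatible X A₂ →
  X ⊆ A₁ ⊎ X ⊆ A₂ ⊎ X ≡ A₁ ∪ A₂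
⊆∪-Compatible _ _ (inj₁ X⊆A₁) _ = inj₁ X⊆A₁
⊆∪-Compatible _ _ _ (inj₁ X⊆A₂) = inj₂ (inj₁ X⊆A₂)
⊆∪-Compatible {A₁ = A₁} {A₂} X⊆ _ (inj₂ (inj₁ A₁⊆X)) (inj₂ (inj₁ A₂⊆X)) =
  inj₂ (inj₂ (⊆-antisym X⊆ λ x∈A₁∪A₂ → [ A₁⊆X , A₂⊆X ]′ (x∈p∪q⁻ A₁ A₂ x∈A₁∪A₂)))
⊆∪-Compatible X⊆ _ (inj₂ (inj₁ _)) (inj₂ (inj₂ empty₂)) = inj₁ (⊆∪∧Empty∩⇒⊆ X⊆ empty₂)
⊆∪-Compatible {A₁ = A₁} {A₂} X⊆ _ (inj₂ (inj₂ empty₁)) (inj₂ (inj₁ _)) =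
  inj₂ (inj₁ (⊆∪∧Empty∩⇒⊆ {A = A₂} {A₁} (λ x∈X → subst (_ ∈_) (∪-comm A₁ A₂) (X⊆ x∈X)) empty₁))
⊆∪-Compatible X⊆ (x , x∈X) (inj₂ (inj₂ empty₁)) (inj₂ (inj₂ empty₂)) =
  ⊥-elim (Empty∩⇒∉ empty₁ x∈X (⊆∪∧Empty∩⇒⊆ X⊆ empty₂ x∈X))

module _ {n : ℕ} where

  class-unique : (P : Partition n) {A B : Subset n} {x : Fin n} →
    IsClass P A → IsClass P B → x ∈ A → x ∈ B → A ≡ B
  class-unique P {A} {B} A∈P B∈P x∈A x∈B with A ≟ˢ B
  ... | yes A≡B = A≡B
  ... | no A≢B = ⊥-elim (Empty∩⇒∉ (disjoint P A B A∈P B∈P A≢B) x∈A x∈B)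

  classOf : Partition n → Fin n → Subset n
  classOf P x = proj₁ (cover P x)

  classOf-isClass : (P : Partition n) (x : Fin n) → IsClass P (classOf P x)
  classOf-isClass P x = proj₁ (proj₂ (cover P x))

  ∈-classOf : (P : Partition n) (x : Fin n) → x ∈ classOf P x
  ∈-classOf P x = proj₂ (proj₂ (cover P x))

  ≤ₚ-refl : {P : Partition n} → P ≤ₚ P
  ≤ₚ-refl A A∈P = A , A∈P , ⊆-refl

  ≤ₚ-trans : {P Q R : Partition n} → P ≤ₚ Q → Q ≤ₚ R → P ≤ₚ R
  ≤ₚ-trans P≤Q Q≤R A A∈P with P≤Q A A∈P
  ... | B , B∈Q , A⊆B with Q≤R B B∈Q
  ... | C , C∈R , B⊆C = C , C∈R , λ x∈A → B⊆C (A⊆B x∈A)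

  ≤ₚ-⊆ : {P Q : Partition n} {A B : Subset n} {x : Fin n} → P ≤ₚ Q →
    IsClass P A → IsClass Q B → x ∈ A → x ∈ B → A ⊆ B
  ≤ₚ-⊆ {Q = Q} {A} P≤Q A∈P B∈Q x∈A x∈B with P≤Q A A∈P
  ... | B′ , B′∈Q , A⊆B′ with class-unique Q B′∈Q B∈Q (A⊆B′ x∈A) x∈B
  ... | refl = A⊆B′

  classOf-⊆ : {P Q : Partition n} {Y : Subset n} {x : Fin n} → P ≤ₚ Q → IsClass Q Y → x ∈ Y → classOf P x ⊆ Y
  classOf-⊆ {P} {Q} P≤Q Y∈Q x∈Y = ≤ₚ-⊆ {P = P} {Q} P≤Q (classOf-isClass P _) Y∈Q (∈-classOf P _) x∈Y

  ≈ₚ⇒≤ₚ : {P Q : Partition n} → P ≈ₚ Q → P ≤ₚ Q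
  ≈ₚ⇒≤ₚ P≈Q A A∈P = A , trans (sym (P≈Q A)) A∈P , ⊆-refl

  ≈ₚ-sym : {P Q : Partition n} → P ≈ₚ Q → Q ≈ₚ P
  ≈ₚ-sym P≈Q A = sym (P≈Q A)

  ≤ₚ-antisym : {P Q : Partition n} → P ≤ₚ Q → Q ≤ₚ P → P ≈ₚ Q
  ≤ₚ-antisym {P} {Q} P≤Q Q≤P A = ≡-true⇔true (transfer {P} {Q} P≤Q Q≤P) (transfer {Q} {P} Q≤P P≤Q)
    where
    transfer : ∀ {P Q : Partition n} → P ≤ₚ Q → Q ≤ₚ P → IsClass P A → IsClass Q A
    transfer {P} {Q} P≤Q Q≤P A∈P with P≤Q A A∈P | nonempty P A A∈P
    ... | C , C∈Q , A⊆C | x , x∈A with ≤ₚ-⊆ {Q} {P} Q≤P C∈Q A∈P (A⊆C x∈A) x∈A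
    ... | C⊆A = subst (IsClass Q) (⊆-antisym C⊆A A⊆C) C∈Q

  <ₚ-trans : {P Q R : Partition n} → P <ₚ Q → Q <ₚ R → P <ₚ R
  <ₚ-trans {P} {Q} {R} (P≤Q , P≉Q) (Q≤R , _) = ≤ₚ-trans {P} {Q} {R} P≤Q Q≤R ,
    λ P≈R → P≉Q (≤ₚ-antisym {P} {Q} P≤Q (≤ₚ-trans {Q} {R} {P} Q≤R (≈ₚ⇒≤ₚ {R} {P} (≈ₚ-sym {P} {R} P≈R))))

  partition : (Block : Subset n → Set) → Decidable Block → (∀ A → Block A → Nonempty A) →
    (∀ A B → Block A → Block B → A ≢ B → Empty (A ∩ B)) → (∀ x → ∃ λ A → Block A × x ∈ A) →
    Partition n
  partition Block Block? nonempty′ disjoint′ cover′ = record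
    { isBlock = λ X → does (Block? X)
    ; nonempty = λ A A∈P → nonempty′ A (does-true⇒ (Block? A) A∈P)
    ; disjoint = λ A B A∈P B∈P → disjoint′ A B (does-true⇒ (Block? A) A∈P) (does-true⇒ (Block? B) B∈P)
    ; cover = λ x → let A , blockA , x∈A = cover′ x in A , dec-true (Block? A) blockA , x∈A
    }

  ⊥ₚ : Partition n
  ⊥ₚ = partition (λ X → ∣ X ∣ ≡ 1) (λ X → ∣ X ∣ ℕ.≟ 1)
    (λ A ∣A∣≡1 → 1≤∣p∣⇒Nonempty A (subst (1 ≤_) (sym ∣A∣≡1) (s≤s z≤n)))
    (λ A B ∣A∣≡1 ∣B∣≡1 A≢B → ∉⇒Empty∩ λ x∈A x∈B → A≢B (⊆-antisym
      (¬NonTrivial⇒⊆ (∣p∣≡1⇒¬NonTrivial {p = A} ∣A∣≡1) x∈A x∈B)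
      (¬NonTrivial⇒⊆ (∣p∣≡1⇒¬NonTrivial {p = B} ∣B∣≡1) x∈B x∈A)))
    (λ x → ⁅ x ⁆ , ∣⁅x⁆∣≡1 x , x∈⁅x⁆ x)

  ⊥ₚ-class⁻ : {X : Subset n} → IsClass ⊥ₚ X → ∣ X ∣ ≡ 1
  ⊥ₚ-class⁻ {X} = does-true⇒ (∣ X ∣ ℕ.≟ 1)

  ⊥ₚ-class⁺ : {X : Subset n} → ∣ X ∣ ≡ 1 → IsClass ⊥ₚ X
  ⊥ₚ-class⁺ {X} = dec-true (∣ X ∣ ℕ.≟ 1)

  ⊥ₚ-minimum : (P : Partition n) → ⊥ₚ ≤ₚ P
  ⊥ₚ-minimum P X X∈⊥ with ⊥ₚ-class⁻ {X} X∈⊥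
  ... | ∣X∣≡1 with 1≤∣p∣⇒Nonempty X (subst (1 ≤_) (sym ∣X∣≡1) (s≤s z≤n))
  ... | x , x∈X = classOf P x , classOf-isClass P x ,
        ¬NonTrivial⇒⊆ (∣p∣≡1⇒¬NonTrivial {p = X} ∣X∣≡1) x∈X (∈-classOf P x)

  MergedClass : Partition n → Subset n → Subset n → Subset n → Set
  MergedClass P A₁ A₂ X = X ≡ A₁ ∪ A₂ ⊎ (IsClass P X × X ≢ A₁ × X ≢ A₂)

  module Merge (P : Partition n) {A₁ A₂ : Subset n} (A₁∈P : IsClass P A₁) (A₂∈P : IsClass P A₂) where

    mergedClass? : Decidable (MergedClass P A₁ A₂)
    mergedClass? X = (X ≟ˢ (A₁ ∪ A₂)) ⊎-dec
      ((isBlock P X ≟ᵇ true) ×-dec (¬? (X ≟ˢ A₁) ×-dec ¬? (X ≟ˢ A₂)))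

    private
      ∉A₁∪A₂ : ∀ {C x} → IsClass P C → C ≢ A₁ → C ≢ A₂ → x ∈ A₁ ∪ A₂ → x ∉ C
      ∉A₁∪A₂ C∈P C≢A₁ C≢A₂ x∈A₁∪A₂ x∈C with x∈p∪q⁻ A₁ A₂ x∈A₁∪A₂
      ... | inj₁ x∈A₁ = C≢A₁ (class-unique P C∈P A₁∈P x∈C x∈A₁)
      ... | inj₂ x∈A₂ = C≢A₂ (class-unique P C∈P A₂∈P x∈C x∈A₂)

      nonempty′ : ∀ A → MergedClass P A₁ A₂ A → Nonempty A
      nonempty′ A (inj₁ refl) = let x , x∈A₁ = nonempty P A₁ A₁∈P in x , p⊆p∪q A₂ x∈A₁
      nonempty′ A (inj₂ (A∈P , _)) = nonempty P A A∈P

      disjoint′ : ∀ A C → MergedClass P A₁ A₂ A → MergedClass P A₁ A₂ C → A ≢ C → Empty (A ∩ C)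
      disjoint′ A C (inj₁ refl) (inj₁ refl) A≢C = ⊥-elim (A≢C refl)
      disjoint′ A C (inj₁ refl) (inj₂ (C∈P , C≢A₁ , C≢A₂)) _ = ∉⇒Empty∩ (∉A₁∪A₂ C∈P C≢A₁ C≢A₂)
      disjoint′ A C (inj₂ (A∈P , A≢A₁ , A≢A₂)) (inj₁ refl) _ =
        ∉⇒Empty∩ λ x∈A x∈C → ∉A₁∪A₂ A∈P A≢A₁ A≢A₂ x∈C x∈A
      disjoint′ A C (inj₂ (A∈P , _)) (inj₂ (C∈P , _)) A≢C = disjoint P A C A∈P C∈P A≢C

      cover′ : ∀ x → ∃ λ A → MergedClass P A₁ A₂ A × x ∈ A
      cover′ x with x ∈? (A₁ ∪ A₂)
      ... | yes x∈A₁∪A₂ = A₁ ∪ A₂ , inj₁ refl , x∈A₁∪A₂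
      ... | no x∉A₁∪A₂ = classOf P x ,
            inj₂ (classOf-isClass P x , ≢A (p⊆p∪q A₂) , ≢A (q⊆p∪q A₁ A₂)) , ∈-classOf P x
        where
        ≢A : ∀ {A} → A ⊆ A₁ ∪ A₂ → classOf P x ≢ A
        ≢A A⊆A₁∪A₂ refl = x∉A₁∪A₂ (A⊆A₁∪A₂ (∈-classOf P x))

    merge : Partition n
    merge = partition (MergedClass P A₁ A₂) mergedClass? nonempty′ disjoint′ cover′

    merge-class⁻ : ∀ {X} → IsClass merge X → MergedClass P A₁ A₂ X
    merge-class⁻ {X} = does-true⇒ (mergedClass? X)

    merge-class⁺ : ∀ {X} → MergedClass P A₁ A₂ X → IsClass merge X
    merge-class⁺ {X} = dec-true (mergedClass? X)

⊤ₚ : ∀ {n} → Partition (suc n)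
⊤ₚ = partition (_≡ ⊤) (_≟ˢ ⊤) (λ A A≡⊤ → zero , subst (zero ∈_) (sym A≡⊤) ∈⊤)
  (λ A B A≡⊤ B≡⊤ A≢B → ⊥-elim (A≢B (trans A≡⊤ (sym B≡⊤)))) (λ x → ⊤ , refl , ∈⊤)

⊤ₚ-class : ∀ {n} → IsClass (⊤ₚ {n}) ⊤
⊤ₚ-class {n} = dec-true (⊤ {suc n} ≟ˢ ⊤) refl

⊤ₚ-maximum : ∀ {n} (P : Partition (suc n)) → P ≤ₚ ⊤ₚ
⊤ₚ-maximum {n} P X _ = ⊤ , ⊤ₚ-class {n} , ⊆⊤

⊤ₚ≤ₚ⇒⊤-class : ∀ {n} {P : Partition (suc n)} → ⊤ₚ ≤ₚ P → IsClass P ⊤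
⊤ₚ≤ₚ⇒⊤-class {n} {P} ⊤ₚ≤P with ⊤ₚ≤P ⊤ (⊤ₚ-class {n})
... | C , C∈P , ⊤⊆C = subst (IsClass P) (⊆-antisym ⊆⊤ ⊤⊆C) C∈P

⊤-class⇒maximum : ∀ {n} {P Q : Partition n} → IsClass P ⊤ → P ≤ₚ Q → Q ≈ₚ P
⊤-class⇒maximum {P = P} {Q} ⊤∈P P≤Q = ≤ₚ-antisym {P = Q} {P} (λ X _ → ⊤ , ⊤∈P , ⊆⊤) P≤Q

-- Merging two classes: the covering relation of the partition lattice

record MergeStep {n} (P Q : Partition n) (B : Subset n) : Set where
  field
    A₁ A₂ : Subset n
    A₁∈P : IsClass P A₁
    A₂∈P : IsClass P A₂
    A₁≢A₂ : A₁ ≢ A₂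
    A₁∪A₂≡B : A₁ ∪ A₂ ≡ B
    class⁻ : ∀ {X} → IsClass Q X → X ≡ B ⊎ (IsClass P X × X ≢ A₁ × X ≢ A₂)
    class⁺ : ∀ {X} → X ≡ B ⊎ (IsClass P X × X ≢ A₁ × X ≢ A₂) → IsClass Q X

  A₁⊆B : A₁ ⊆ B
  A₁⊆B {x} x∈A₁ = subst (x ∈_) A₁∪A₂≡B (p⊆p∪q A₂ x∈A₁)

  A₂⊆B : A₂ ⊆ B
  A₂⊆B {x} x∈A₂ = subst (x ∈_) A₁∪A₂≡B (q⊆p∪q A₁ A₂ x∈A₂)

  ∈B⇒∈A₁⊎∈A₂ : ∀ {x} → x ∈ B → x ∈ A₁ ⊎ x ∈ A₂
  ∈B⇒∈A₁⊎∈A₂ {x} x∈B = x∈p∪q⁻ A₁ A₂ (subst (x ∈_) (sym A₁∪A₂≡B) x∈B)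

  A₁∩A₂-empty : Empty (A₁ ∩ A₂)
  A₁∩A₂-empty = disjoint P A₁ A₂ A₁∈P A₂∈P A₁≢A₂

  B∈Q : IsClass Q B
  B∈Q = class⁺ (inj₁ refl)

  B-NonTrivial : NonTrivial B
  B-NonTrivial with nonempty P A₁ A₁∈P | nonempty P A₂ A₂∈P
  ... | a₁ , a₁∈A₁ | a₂ , a₂∈A₂ = distinct⇒NonTrivial (A₁⊆B a₁∈A₁) (A₂⊆B a₂∈A₂)
        λ { refl → Empty∩⇒∉ A₁∩A₂-empty a₁∈A₁ a₂∈A₂ }

  B⊈class : ∀ C → IsClass P C → ¬ (B ⊆ C)
  B⊈class C C∈P B⊆C with nonempty P A₁ A₁∈P | nonempty P A₂ A₂∈P
  ... | a₁ , a₁∈A₁ | a₂ , a₂∈A₂ with class-unique P C∈P A₁∈P (B⊆C (A₁⊆B a₁∈A₁)) a₁∈A₁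
  ... | refl = Empty∩⇒∉ A₁∩A₂-empty (B⊆C (A₂⊆B a₂∈A₂)) a₂∈A₂

  meets-B⇒⊆B : ∀ {X x} → IsClass P X → x ∈ X → x ∈ B → X ⊆ B
  meets-B⇒⊆B X∈P x∈X x∈B with ∈B⇒∈A₁⊎∈A₂ x∈B
  ... | inj₁ x∈A₁ rewrite class-unique P X∈P A₁∈P x∈X x∈A₁ = A₁⊆B
  ... | inj₂ x∈A₂ rewrite class-unique P X∈P A₂∈P x∈X x∈A₂ = A₂⊆B

  class⁻′ : ∀ {X} → IsClass Q X → X ≡ B ⊎ IsClass P X
  class⁻′ X∈Q with class⁻ X∈Q
  ... | inj₁ X≡B = inj₁ X≡B
  ... | inj₂ (X∈P , _) = inj₂ X∈P

  P≤Q : P ≤ₚ Q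
  P≤Q X X∈P with X ≟ˢ A₁ | X ≟ˢ A₂
  ... | yes refl | _ = B , B∈Q , A₁⊆B
  ... | no _ | yes refl = B , B∈Q , A₂⊆B
  ... | no X≢A₁ | no X≢A₂ = X , class⁺ (inj₂ (X∈P , X≢A₁ , X≢A₂)) , ⊆-refl

  P<Q : P <ₚ Q
  P<Q = P≤Q , λ P≈Q → B⊈class B (trans (P≈Q B) B∈Q) ⊆-refl

  -- Q is determined by P and B alone: its classes are B and the classes of P disjoint from B.
  class⁻-disjoint : ∀ {X} → IsClass Q X → X ≡ B ⊎ (IsClass P X × Empty (X ∩ B))
  class⁻-disjoint {X} X∈Q with class⁻ X∈Q
  ... | inj₁ X≡B = inj₁ X≡B
  ... | inj₂ (X∈P , X≢A₁ , X≢A₂) = inj₂ (X∈P , ∉⇒Empty∩ ∉B)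
    where
    ∉B : ∀ {x} → x ∈ X → x ∉ B
    ∉B x∈X x∈B with ∈B⇒∈A₁⊎∈A₂ x∈B
    ... | inj₁ x∈A₁ = X≢A₁ (class-unique P X∈P A₁∈P x∈X x∈A₁)
    ... | inj₂ x∈A₂ = X≢A₂ (class-unique P X∈P A₂∈P x∈X x∈A₂)

  class⁺-disjoint : ∀ {X} → X ≡ B ⊎ (IsClass P X × Empty (X ∩ B)) → IsClass Q X
  class⁺-disjoint (inj₁ X≡B) = class⁺ (inj₁ X≡B)
  class⁺-disjoint {X} (inj₂ (X∈P , empty)) = class⁺ (inj₂ (X∈P , ≢B-part A₁⊆B A₁∈P , ≢B-part A₂⊆B A₂∈P))
    where
    ≢B-part : ∀ {A} → A ⊆ B → IsClass P A → X ≢ A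
    ≢B-part {A} A⊆B A∈P refl = let x , x∈A = nonempty P A A∈P in Empty∩⇒∉ empty x∈A (A⊆B x∈A)

module _ {n : ℕ} {P : Partition n} where

  merge-MergeStep : ∀ {A₁ A₂} (A₁∈P : IsClass P A₁) (A₂∈P : IsClass P A₂) → A₁ ≢ A₂ →
    MergeStep P (Merge.merge P A₁∈P A₂∈P) (A₁ ∪ A₂)
  merge-MergeStep A₁∈P A₂∈P A₁≢A₂ = record
    { A₁∈P = A₁∈P ; A₂∈P = A₂∈P ; A₁≢A₂ = A₁≢A₂ ; A₁∪A₂≡B = refl
    ; class⁻ = Merge.merge-class⁻ P A₁∈P A₂∈P ; class⁺ = Merge.merge-class⁺ P A₁∈P A₂∈P }

  MergeStep-resp-≈ₚ : ∀ {Q R B} → MergeStep P Q B → Q ≈ₚ R → MergeStep P R B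
  MergeStep-resp-≈ₚ {Q} {R} s Q≈R = record
    { A₁∈P = A₁∈P ; A₂∈P = A₂∈P ; A₁≢A₂ = A₁≢A₂ ; A₁∪A₂≡B = A₁∪A₂≡B
    ; class⁻ = λ {X} X∈R → class⁻ (trans (Q≈R X) X∈R) ; class⁺ = λ {X} h → trans (sym (Q≈R X)) (class⁺ h) }
    where open MergeStep s

  MergeStep-functional : ∀ {P′ Q Q′ B} → MergeStep P Q B → MergeStep P′ Q′ B → P ≈ₚ P′ → Q ≈ₚ Q′
  MergeStep-functional {P′} {Q} {Q′} s s′ P≈P′ X = ≡-true⇔true to from
    where
    to : IsClass Q X → IsClass Q′ X
    to X∈Q with MergeStep.class⁻-disjoint s X∈Q
    ... | inj₁ X≡B = MergeStep.class⁺-disjoint s′ (inj₁ X≡B)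
    ... | inj₂ (X∈P , empty) = MergeStep.class⁺-disjoint s′ (inj₂ (trans (sym (P≈P′ X)) X∈P , empty))
    from : IsClass Q′ X → IsClass Q X
    from X∈Q′ with MergeStep.class⁻-disjoint s′ X∈Q′
    ... | inj₁ X≡B = MergeStep.class⁺-disjoint s (inj₁ X≡B)
    ... | inj₂ (X∈P′ , empty) = MergeStep.class⁺-disjoint s (inj₂ (trans (P≈P′ X) X∈P′ , empty))

  -- Either B lies inside a class of Q, and then R ≤ Q; or every class of Q inside B lies inside A₁ or A₂,
  -- and then Q ≤ P.
  MergeStep-covers : ∀ {Q R B} → MergeStep P R B → P ≤ₚ Q → Q ≤ₚ R → Q ≈ₚ P ⊎ Q ≈ₚ R
  MergeStep-covers {Q} {R} {B} s P≤Q Q≤R with anySubset? (λ D → (isBlock Q D ≟ᵇ true) ×-dec (B ⊆? D))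
  ... | yes (D , D∈Q , B⊆D) = inj₂ (≤ₚ-antisym {P = Q} {R} Q≤R R≤Q)
    where
    open MergeStep s using (class⁻′)
    R≤Q : R ≤ₚ Q
    R≤Q X X∈R with class⁻′ X∈R
    ... | inj₁ refl = D , D∈Q , B⊆D
    ... | inj₂ X∈P = P≤Q X X∈P
  ... | no B⊈Q = inj₁ (≤ₚ-antisym {P = Q} {P} Q≤P P≤Q)
    where
    open MergeStep s using (A₁; A₂; A₁∈P; A₂∈P; class⁻′; ∈B⇒∈A₁⊎∈A₂)
    inside : ∀ {X A A′ x} → IsClass Q X → IsClass P A → IsClass P A′ → (∀ {y} → y ∈ B → y ∈ A ⊎ y ∈ A′) →
      X ⊆ B → x ∈ X → x ∈ A → X ⊆ A
    inside {X} X∈Q A∈P A′∈P B⊆A∪A′ X⊆B x∈X x∈A y∈X with B⊆A∪A′ (X⊆B y∈X)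
    ... | inj₁ y∈A = y∈A
    ... | inj₂ y∈A′ = ⊥-elim (B⊈Q (X , X∈Q , B⊆X))
      where
      B⊆X : B ⊆ X
      B⊆X z∈B with B⊆A∪A′ z∈B
      ... | inj₁ z∈A = ≤ₚ-⊆ {P = P} {Q} P≤Q A∈P X∈Q x∈A x∈X z∈A
      ... | inj₂ z∈A′ = ≤ₚ-⊆ {P = P} {Q} P≤Q A′∈P X∈Q y∈A′ y∈X z∈A′
    Q≤P : Q ≤ₚ P
    Q≤P X X∈Q with Q≤R X X∈Q
    ... | Y , Y∈R , X⊆Y with class⁻′ Y∈R
    ... | inj₂ Y∈P = Y , Y∈P , X⊆Y
    ... | inj₁ refl with nonempty Q X X∈Q
    ... | x , x∈X with ∈B⇒∈A₁⊎∈A₂ (X⊆Y x∈X)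
    ... | inj₁ x∈A₁ = A₁ , A₁∈P , inside X∈Q A₁∈P A₂∈P ∈B⇒∈A₁⊎∈A₂ X⊆Y x∈X x∈A₁
    ... | inj₂ x∈A₂ = A₂ , A₂∈P , inside X∈Q A₂∈P A₁∈P (λ y∈B → swap (∈B⇒∈A₁⊎∈A₂ y∈B)) X⊆Y x∈X x∈A₂

<ₚ⇒¬≥ₚ : ∀ {n} {P Q : Partition n} → P <ₚ Q → ¬ Q ≤ₚ P
<ₚ⇒¬≥ₚ {P = P} {Q} (P≤Q , P≉Q) Q≤P = P≉Q (≤ₚ-antisym {P = P} {Q} P≤Q Q≤P)

<ₚ⇒two-classes : ∀ {n} {P Q : Partition n} → P <ₚ Q →
  ∃ λ Y → IsClass Q Y × ∃₂ λ A₁ A₂ → IsClass P A₁ × IsClass P A₂ × A₁ ≢ A₂ × A₁ ⊆ Y × A₂ ⊆ Y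
<ₚ⇒two-classes {P = P} {Q} P<Q@(P≤Q , _)
  with anySubset? (λ Y → (isBlock Q Y ≟ᵇ true) ×-dec ¬? (isBlock P Y ≟ᵇ true))
... | no noNewClass = ⊥-elim (<ₚ⇒¬≥ₚ {P = P} {Q} P<Q Q≤P)
  where
  Q≤P : Q ≤ₚ P
  Q≤P Y Y∈Q with isBlock P Y ≟ᵇ true
  ... | yes Y∈P = Y , Y∈P , ⊆-refl
  ... | no Y∉P = ⊥-elim (noNewClass (Y , Y∈Q , Y∉P))
... | yes (Y , Y∈Q , Y∉P) with nonempty Q Y Y∈Q
... | x , x∈Y with ⊆∧≢⇒∃∉ (classOf-⊆ {P = P} {Q} P≤Q Y∈Q x∈Y) (λ { refl → Y∉P (classOf-isClass P x) })
... | y , y∈Y , y∉A₁ = Y , Y∈Q , classOf P x , classOf P y ,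
      classOf-isClass P x , classOf-isClass P y , (λ A₁≡A₂ → y∉A₁ (subst (y ∈_) (sym A₁≡A₂) (∈-classOf P y))) ,
      classOf-⊆ {P = P} {Q} P≤Q Y∈Q x∈Y , classOf-⊆ {P = P} {Q} P≤Q Y∈Q y∈Y

-- Maximal chains are exactly the chains obtained by merging two classes at a time

Saturated : ∀ {n} → List (Partition n) → Set
Saturated {n} K = ∀ (Q : Partition n) → (∀ P → P ∈ₗ K → Q ≤ₚ P ⊎ P ≤ₚ Q) → Any (Q ≈ₚ_) K

data MergeSteps {n} : Partition n → List (Partition n) → List (Subset n) → Set where
  done : ∀ {P} → IsClass P ⊤ → MergeSteps P [] []
  step : ∀ {P Q K B Bs} → MergeStep P Q B → MergeSteps Q K Bs → MergeSteps P (Q ∷ K) (B ∷ Bs)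

module _ {n : ℕ} {K : List (Partition (suc n))} (saturated : Saturated K) where

  -- The merge R of two P-classes inside one Q-class satisfies P < R ≤ Q and is comparable with
  -- the whole chain, so saturation forces R ≈ Q.
  consecutive⇒MergeStep : ∀ pre {P Q post} → pre ++ P ∷ Q ∷ post ≡ K →
    All (_<ₚ P) pre → P <ₚ Q → All (Q <ₚ_) post → ∃ (MergeStep P Q)
  consecutive⇒MergeStep pre {P} {Q} {post} K≡ below P<Q above with <ₚ⇒two-classes {P = P} {Q} P<Q
  ... | Y , Y∈Q , A₁ , A₂ , A₁∈P , A₂∈P , A₁≢A₂ , A₁⊆Y , A₂⊆Y =
    A₁ ∪ A₂ , MergeStep-resp-≈ₚ s R≈Q
    where
    R : Partition (suc n)
    R = Merge.merge P A₁∈P A₂∈P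
    s : MergeStep P R (A₁ ∪ A₂)
    s = merge-MergeStep A₁∈P A₂∈P A₁≢A₂
    P<R : P <ₚ R
    P<R = MergeStep.P<Q s
    P≤R : P ≤ₚ R
    P≤R = proj₁ P<R
    R≤Q : R ≤ₚ Q
    R≤Q X X∈R with MergeStep.class⁻′ s X∈R
    ... | inj₁ refl = Y , Y∈Q , λ x∈A₁∪A₂ → [ A₁⊆Y , A₂⊆Y ]′ (x∈p∪q⁻ A₁ A₂ x∈A₁∪A₂)
    ... | inj₂ X∈P = proj₁ P<Q X X∈P
    position : ∀ {M} → M ∈ₗ K → M ∈ₗ pre ⊎ M ≡ P ⊎ M ≡ Q ⊎ M ∈ₗ post
    position M∈K with ∈-++⁻ pre (subst (_ ∈ₗ_) (sym K≡) M∈K)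
    ... | inj₁ M∈pre = inj₁ M∈pre
    ... | inj₂ (here refl) = inj₂ (inj₁ refl)
    ... | inj₂ (there (here refl)) = inj₂ (inj₂ (inj₁ refl))
    ... | inj₂ (there (there M∈post)) = inj₂ (inj₂ (inj₂ M∈post))
    comparable : ∀ M → M ∈ₗ K → R ≤ₚ M ⊎ M ≤ₚ R
    comparable M M∈K with position M∈K
    ... | inj₁ M∈pre = inj₂ (≤ₚ-trans {P = M} {P} {R} (proj₁ (All.lookup below M∈pre)) P≤R)
    ... | inj₂ (inj₁ refl) = inj₂ P≤R
    ... | inj₂ (inj₂ (inj₁ refl)) = inj₁ R≤Q
    ... | inj₂ (inj₂ (inj₂ M∈post)) = inj₁ (≤ₚ-trans {P = R} {Q} {M} R≤Q (proj₁ (All.lookup above M∈post)))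
    R≈Q : R ≈ₚ Q
    R≈Q with find (saturated R comparable)
    ... | M , M∈K , R≈M with position M∈K
    ... | inj₁ M∈pre = ⊥-elim (<ₚ⇒¬≥ₚ {P = P} {R} P<R
          (≤ₚ-trans {P = R} {M} {P} (≈ₚ⇒≤ₚ {P = R} {M} R≈M) (proj₁ (All.lookup below M∈pre))))
    ... | inj₂ (inj₁ refl) = ⊥-elim (<ₚ⇒¬≥ₚ {P = P} {R} P<R (≈ₚ⇒≤ₚ {P = R} {M} R≈M))
    ... | inj₂ (inj₂ (inj₁ refl)) = R≈M
    ... | inj₂ (inj₂ (inj₂ M∈post)) = ⊥-elim (<ₚ⇒¬≥ₚ {P = Q} {M} (All.lookup above M∈post)
          (≤ₚ-trans {P = M} {R} {Q} (≈ₚ⇒≤ₚ {P = M} {R} (≈ₚ-sym {P = R} {M} R≈M)) R≤Q))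

  last-⊤-class : ∀ pre {P} → pre ++ [ P ] ≡ K → All (_<ₚ P) pre → IsClass P ⊤
  last-⊤-class pre {P} K≡ below = ⊤ₚ≤ₚ⇒⊤-class {P = P} ⊤ₚ≤P
    where
    ⊤ₚ≤P : ⊤ₚ ≤ₚ P
    ⊤ₚ≤P with find (saturated ⊤ₚ (λ M _ → inj₂ (⊤ₚ-maximum M)))
    ... | M , M∈K , ⊤≈M with ∈-++⁻ pre (subst (_ ∈ₗ_) (sym K≡) M∈K)
    ... | inj₁ M∈pre = ≤ₚ-trans {P = ⊤ₚ} {M} {P} (≈ₚ⇒≤ₚ {P = ⊤ₚ} {M} ⊤≈M) (proj₁ (All.lookup below M∈pre))
    ... | inj₂ (here refl) = ≈ₚ⇒≤ₚ {P = ⊤ₚ} {M} ⊤≈M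

  chain⇒MergeSteps : ∀ pre {P rest} → pre ++ P ∷ rest ≡ K → All (_<ₚ P) pre →
    AllPairs _<ₚ_ (P ∷ rest) → ∃ (MergeSteps P rest)
  chain⇒MergeSteps pre {P} {[]} K≡ below _ = [] , done (last-⊤-class pre K≡ below)
  chain⇒MergeSteps pre {P} {Q ∷ rest} K≡ below ((P<Q ∷ _) ∷ Q<rest@(above ∷ _))
    with consecutive⇒MergeStep pre K≡ below P<Q above
       | chain⇒MergeSteps (pre ++ [ P ]) (trans (++-assoc pre [ P ] (Q ∷ rest)) K≡)
           (All.++⁺ (All.map (λ {M} M<P → <ₚ-trans {P = M} {P} {Q} M<P P<Q) below) (P<Q ∷ [])) Q<rest
  ... | B , s | Bs , steps = B ∷ Bs , step s steps

module _ {n : ℕ} where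

  maximalChain-nonempty : ¬ IsMaximalChain {n} []
  maximalChain-nonempty (_ , saturated) with saturated ⊥ₚ (λ P ())
  ... | ()

maximalChain⇒MergeSteps : ∀ {n} {Π₀ : Partition (suc n)} {K₁} → IsMaximalChain (Π₀ ∷ K₁) →
  Π₀ ≤ₚ ⊥ₚ × ∃ (MergeSteps Π₀ K₁)
maximalChain⇒MergeSteps {n} {Π₀} {K₁} (linked , saturated)
  with Linked⇒AllPairs (λ {P} {Q} {R} → <ₚ-trans {P = P} {Q} {R}) linked
... | chain@(Π₀<K₁ ∷ _) = Π₀≤⊥ₚ , chain⇒MergeSteps saturated [] refl [] chain
  where
  Π₀≤⊥ₚ : Π₀ ≤ₚ ⊥ₚ
  Π₀≤⊥ₚ with find (saturated ⊥ₚ (λ M _ → inj₁ (⊥ₚ-minimum M)))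
  ... | M , here refl , ⊥≈M = ≈ₚ⇒≤ₚ {P = M} {⊥ₚ} (≈ₚ-sym {P = ⊥ₚ} {M} ⊥≈M)
  ... | M , there M∈K₁ , ⊥≈M =
    ≤ₚ-trans {P = Π₀} {M} {⊥ₚ} (proj₁ (All.lookup Π₀<K₁ M∈K₁)) (≈ₚ⇒≤ₚ {P = M} {⊥ₚ} (≈ₚ-sym {P = ⊥ₚ} {M} ⊥≈M))

module _ {n : ℕ} where

  MergeSteps⇒Linked : ∀ {P : Partition n} {K Bs} → MergeSteps P K Bs → Linked _<ₚ_ (P ∷ K)
  MergeSteps⇒Linked (done _) = [-]
  MergeSteps⇒Linked (step s steps) = MergeStep.P<Q s ∷ MergeSteps⇒Linked steps

  MergeSteps-saturated : ∀ {P : Partition n} {K Bs} → MergeSteps P K Bs → ∀ Q → P ≤ₚ Q →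
    (∀ M → M ∈ₗ K → Q ≤ₚ M ⊎ M ≤ₚ Q) → Any (Q ≈ₚ_) (P ∷ K)
  MergeSteps-saturated {P} (done ⊤∈P) Q P≤Q _ = here (⊤-class⇒maximum {P = P} {Q} ⊤∈P P≤Q)
  MergeSteps-saturated {P} (step {Q = P′} s steps) Q P≤Q comparable with comparable P′ (here refl)
  ... | inj₂ P′≤Q = there (MergeSteps-saturated steps Q P′≤Q (λ M M∈K → comparable M (there M∈K)))
  ... | inj₁ Q≤P′ with MergeStep-covers {Q = Q} s P≤Q Q≤P′
  ...   | inj₁ Q≈P = here Q≈P
  ...   | inj₂ Q≈P′ = there (here Q≈P′)

  MergeSteps⇒maximalChain : ∀ {K Bs} → MergeSteps ⊥ₚ K Bs → IsMaximalChain (⊥ₚ ∷ K)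
  MergeSteps⇒maximalChain steps = MergeSteps⇒Linked steps ,
    λ Q comparable → MergeSteps-saturated steps Q (⊥ₚ-minimum Q) (λ M M∈K → comparable M (there M∈K))

  MergeSteps-injective : ∀ {P P′ : Partition n} {K K′ Bs} → MergeSteps P K Bs → MergeSteps P′ K′ Bs →
    P ≈ₚ P′ → Pointwise _≈ₚ_ K K′
  MergeSteps-injective (done _) (done _) _ = []
  MergeSteps-injective (step {Q = Q} s steps) (step {Q = Q′} s′ steps′) P≈P′ =
    Q≈Q′ ∷ MergeSteps-injective steps steps′ Q≈Q′
    where
    Q≈Q′ : Q ≈ₚ Q′
    Q≈Q′ = MergeStep-functional s s′ P≈P′

-- Reading off the classes created along a chain

filter-map : ∀ {a b} {A : Set a} {B : Set b} (p : B → Bool) (f : A → B) (xs : List A) →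
  filter (λ y → T? (p y)) (map f xs) ≡ map f (filter (λ x → T? (p (f x))) xs)
filter-map p f [] = refl
filter-map p f (x ∷ xs) with p (f x)
... | true = cong (f x ∷_) (filter-map p f xs)
... | false = filter-map p f xs

filter-false : ∀ {a} {A : Set a} (p : A → Bool) → (∀ x → p x ≢ true) → ∀ xs → filter (λ x → T? (p x)) xs ≡ []
filter-false p never [] = refl
filter-false p never (x ∷ xs) with p x in px
... | true = ⊥-elim (never x px)
... | false = filter-false p never xs

filter-allSubsets-∷ : ∀ {n} (p : Subset (suc n) → Bool) {xs ys} →
  filter (λ X → T? (p (true ∷ X))) (allSubsets n) ≡ xs → filter (λ X → T? (p (false ∷ X))) (allSubsets n) ≡ ys →
  filter (λ X → T? (p X)) (allSubsets (suc n)) ≡ map (true ∷_) xs ++ map (false ∷_) ys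
filter-allSubsets-∷ {n} p refl refl = trans
  (filter-++ (λ X → T? (p X)) (map (true ∷_) (allSubsets n)) (map (false ∷_) (allSubsets n)))
  (cong₂ _++_ (filter-map p (true ∷_) (allSubsets n)) (filter-map p (false ∷_) (allSubsets n)))

filter-allSubsets-singleton : ∀ n (p : Subset n → Bool) {B} → p B ≡ true → (∀ X → p X ≡ true → X ≡ B) →
  filter (λ X → T? (p X)) (allSubsets n) ≡ [ B ]
filter-allSubsets-singleton zero p {[]} pB _ rewrite pB = refl
filter-allSubsets-singleton (suc n) p {true ∷ B} pB onlyB = filter-allSubsets-∷ p
  (filter-allSubsets-singleton n (λ X → p (true ∷ X)) pB (λ X pX → ∷-injectiveʳ (onlyB (true ∷ X) pX)))
  (filter-false (λ X → p (false ∷ X)) (λ X pX → case onlyB (false ∷ X) pX of λ ()) (allSubsets n))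
filter-allSubsets-singleton (suc n) p {false ∷ B} pB onlyB = filter-allSubsets-∷ p
  (filter-false (λ X → p (true ∷ X)) (λ X pX → case onlyB (true ∷ X) pX of λ ()) (allSubsets n))
  (filter-allSubsets-singleton n (λ X → p (false ∷ X)) pB (λ X pX → ∷-injectiveʳ (onlyB (false ∷ X) pX)))

module _ {n : ℕ} where

  any-≟⇒∈ : (X : Subset n) (xs : List (Subset n)) → any (λ C → does (X ≟ˢ C)) xs ≡ true → X ∈ₗ xs
  any-≟⇒∈ X (C ∷ xs) found with X ≟ˢ C
  ... | yes X≡C = here X≡C
  ... | no _ = there (any-≟⇒∈ X xs found)

  ∈⇒any-≟ : (X : Subset n) (xs : List (Subset n)) → X ∈ₗ xs → any (λ C → does (X ≟ˢ C)) xs ≡ true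
  ∈⇒any-≟ X (C ∷ xs) X∈ with X ≟ˢ C | X∈
  ... | yes _ | _ = refl
  ... | no X≢C | here X≡C = ⊥-elim (X≢C X≡C)
  ... | no _ | there X∈xs = ∈⇒any-≟ X xs X∈xs

  -- The non-trivial sets that have appeared as classes up to P, in order of first appearance.
  record History (P : Partition n) (seen : List (Subset n)) : Set where
    field
      class-seen : ∀ X → IsClass P X → NonTrivial X → X ∈ₗ seen
      seen-inside : ∀ X → X ∈ₗ seen → ∃ λ C → IsClass P C × X ⊆ C
      seen-nonTrivial : ∀ X → X ∈ₗ seen → NonTrivial X
      seen-unique : Unique seen
      seen-compatible : ∀ X Y → X ∈ₗ seen → Y ∈ₗ seen → Compatible X Y
      seen-ordered : ∀ A B → A ∈ₗ seen → B ∈ₗ seen → A ⊆ B → A ≢ B → (A ∷ B ∷ []) ⊑ seen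
      seen-maximal : ∀ X → NonTrivial X → (∀ Y → Y ∈ₗ seen → Compatible X Y) →
        (∃ λ C → IsClass P C × X ⊆ C) → X ∈ₗ seen

  History-start : {P : Partition n} → P ≤ₚ ⊥ₚ → History P []
  History-start {P} P≤⊥ₚ = record
    { class-seen = λ X X∈P nt → ⊥-elim (trivial (X , X∈P , ⊆-refl) nt)
    ; seen-inside = λ X () ; seen-nonTrivial = λ X () ; seen-unique = []
    ; seen-compatible = λ X Y () ; seen-ordered = λ A B ()
    ; seen-maximal = λ X nt _ inside → ⊥-elim (trivial inside nt) }
    where
    trivial : ∀ {X} → (∃ λ C → IsClass P C × X ⊆ C) → ¬ NonTrivial X
    trivial {X} (C , C∈P , X⊆C) nt with P≤⊥ₚ C C∈P
    ... | D , D∈⊥ , C⊆D = ∣p∣≡1⇒¬NonTrivial {p = D} (⊥ₚ-class⁻ {X = D} D∈⊥) (NonTrivial-mono (λ x∈X → C⊆D (X⊆C x∈X)) nt)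

module _ {n : ℕ} {P Q : Partition n} {B : Subset n} {seen : List (Subset n)}
         (s : MergeStep P Q B) (H : History P seen) where

  open History H
  open MergeStep s using (A₁; A₂; A₁∈P; A₂∈P; A₁∪A₂≡B; B∈Q; B⊈class; B-NonTrivial; class⁻′)

  private
    seen′ : List (Subset n)
    seen′ = seen ++ [ B ]

    B∉seen : B ∈ₗ seen → ⊥
    B∉seen B∈seen with seen-inside B B∈seen
    ... | C , C∈P , B⊆C = B⊈class C C∈P B⊆C

    seen-inside-Q : ∀ X → X ∈ₗ seen → ∃ λ C → IsClass Q C × X ⊆ C
    seen-inside-Q X X∈seen with seen-inside X X∈seen
    ... | C , C∈P , X⊆C with MergeStep.P≤Q s C C∈P
    ... | D , D∈Q , C⊆D = D , D∈Q , λ x∈X → C⊆D (X⊆C x∈X)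

    seen-compatible-B : ∀ X → X ∈ₗ seen → Compatible X B
    seen-compatible-B X X∈seen with seen-inside-Q X X∈seen
    ... | D , D∈Q , X⊆D with D ≟ˢ B
    ... | yes refl = inj₁ X⊆D
    ... | no D≢B = inj₂ (inj₂ (∉⇒Empty∩ λ x∈X → Empty∩⇒∉ (disjoint Q D B D∈Q B∈Q D≢B) (X⊆D x∈X)))

    class-compatible : ∀ {X} → (∀ Y → Y ∈ₗ seen → Compatible X Y) → ∀ A → IsClass P A → Compatible X A
    class-compatible compatible A A∈P with 2 ≤? ∣ A ∣
    ... | yes nt = compatible A (class-seen A A∈P nt)
    ... | no ¬nt = Compatible-sym (¬NonTrivial⇒Compatible ¬nt)

    seen-maximal-B : ∀ X → NonTrivial X → (∀ Y → Y ∈ₗ seen → Compatible X Y) → X ⊆ B → X ∈ₗ seen′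
    seen-maximal-B X nt compatible X⊆B
      with ⊆∪-Compatible (λ x∈X → subst (_ ∈_) (sym A₁∪A₂≡B) (X⊆B x∈X)) (NonTrivial⇒Nonempty nt)
             (class-compatible compatible A₁ A₁∈P) (class-compatible compatible A₂ A₂∈P)
    ... | inj₁ X⊆A₁ = ∈-++⁺ˡ (seen-maximal X nt compatible (A₁ , A₁∈P , X⊆A₁))
    ... | inj₂ (inj₁ X⊆A₂) = ∈-++⁺ˡ (seen-maximal X nt compatible (A₂ , A₂∈P , X⊆A₂))
    ... | inj₂ (inj₂ X≡A₁∪A₂) = ∈-++⁺ʳ seen (here (trans X≡A₁∪A₂ A₁∪A₂≡B))

    class-seen′ : ∀ X → IsClass Q X → NonTrivial X → X ∈ₗ seen′
    class-seen′ X X∈Q nt with class⁻′ X∈Q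
    ... | inj₁ refl = ∈-++⁺ʳ seen (here refl)
    ... | inj₂ X∈P = ∈-++⁺ˡ (class-seen X X∈P nt)

    seen-inside′ : ∀ X → X ∈ₗ seen′ → ∃ λ C → IsClass Q C × X ⊆ C
    seen-inside′ X X∈ with ∈-++⁻ seen X∈
    ... | inj₁ X∈seen = seen-inside-Q X X∈seen
    ... | inj₂ (here refl) = B , B∈Q , ⊆-refl

    seen-nonTrivial′ : ∀ X → X ∈ₗ seen′ → NonTrivial X
    seen-nonTrivial′ X X∈ with ∈-++⁻ seen X∈
    ... | inj₁ X∈seen = seen-nonTrivial X X∈seen
    ... | inj₂ (here refl) = B-NonTrivial

    seen-compatible′ : ∀ X Y → X ∈ₗ seen′ → Y ∈ₗ seen′ → Compatible X Y
    seen-compatible′ X Y X∈ Y∈ with ∈-++⁻ seen X∈ | ∈-++⁻ seen Y∈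
    ... | inj₁ X∈seen | inj₁ Y∈seen = seen-compatible X Y X∈seen Y∈seen
    ... | inj₁ X∈seen | inj₂ (here refl) = seen-compatible-B X X∈seen
    ... | inj₂ (here refl) | inj₁ Y∈seen = Compatible-sym (seen-compatible-B Y Y∈seen)
    ... | inj₂ (here refl) | inj₂ (here refl) = inj₁ ⊆-refl

    seen-ordered′ : ∀ A C → A ∈ₗ seen′ → C ∈ₗ seen′ → A ⊆ C → A ≢ C → (A ∷ C ∷ []) ⊑ seen′
    seen-ordered′ A C A∈ C∈ A⊆C A≢C with ∈-++⁻ seen A∈ | ∈-++⁻ seen C∈
    ... | inj₁ A∈seen | inj₁ C∈seen = Sublist.++⁺ʳ [ B ] (seen-ordered A C A∈seen C∈seen A⊆C A≢C)
    ... | inj₁ A∈seen | inj₂ (here refl) = Sublist.++⁺ (from∈ A∈seen) ⊑-refl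
    ... | inj₂ (here refl) | inj₂ (here refl) = ⊥-elim (A≢C refl)
    ... | inj₂ (here refl) | inj₁ C∈seen with seen-inside C C∈seen
    ...   | D , D∈P , C⊆D = ⊥-elim (B⊈class D D∈P λ x∈B → C⊆D (A⊆C x∈B))

    seen-maximal′ : ∀ X → NonTrivial X → (∀ Y → Y ∈ₗ seen′ → Compatible X Y) →
      (∃ λ C → IsClass Q C × X ⊆ C) → X ∈ₗ seen′
    seen-maximal′ X nt compatible (D , D∈Q , X⊆D) with class⁻′ D∈Q
    ... | inj₁ refl = seen-maximal-B X nt compatible-seen X⊆D
      where
      compatible-seen : ∀ Y → Y ∈ₗ seen → Compatible X Y
      compatible-seen Y Y∈seen = compatible Y (∈-++⁺ˡ Y∈seen)
    ... | inj₂ D∈P = ∈-++⁺ˡ (seen-maximal X nt (λ Y Y∈ → compatible Y (∈-++⁺ˡ Y∈)) (D , D∈P , X⊆D))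

  History-step : History Q (seen ++ [ B ])
  History-step = record
    { class-seen = class-seen′
    ; seen-inside = seen-inside′
    ; seen-nonTrivial = seen-nonTrivial′
    ; seen-unique = Unique.++⁺ seen-unique ([] ∷ []) λ { (B∈seen , here refl) → B∉seen B∈seen }
    ; seen-compatible = seen-compatible′
    ; seen-ordered = seen-ordered′
    ; seen-maximal = seen-maximal′
    }

  newClasses-MergeStep : newClasses seen Q ≡ [ B ]
  newClasses-MergeStep = filter-allSubsets-singleton n new new-B new⇒≡B
    where
    new : Subset n → Bool
    new X = isBlock Q X ∧ nonTrivial? X ∧ not (any (λ C → does (X ≟ˢ C)) seen)
    new-B : new B ≡ true
    new-B rewrite B∈Q | dec-true (2 ≤? ∣ B ∣) B-NonTrivial | ¬-not (λ found → B∉seen (any-≟⇒∈ B seen found)) = refl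
    new⇒≡B : ∀ X → new X ≡ true → X ≡ B
    new⇒≡B X newX with ∧-true⁻ {isBlock Q X} newX
    ... | X∈Q , rest with ∧-true⁻ {nonTrivial? X} rest | class⁻′ X∈Q
    ...   | _ , _ | inj₁ X≡B = X≡B
    ...   | nt , fresh | inj₂ X∈P with
            trans (sym (∈⇒any-≟ X seen (class-seen X X∈P (does-true⇒ (2 ≤? ∣ X ∣) nt)))) (not-true⁻ fresh)
    ...     | ()

classesFrom-MergeSteps : ∀ {n} {P : Partition n} {K Bs seen} → MergeSteps P K Bs → History P seen →
  classesFrom seen K ≡ Bs × ∃ λ R → IsClass R ⊤ × History R (seen ++ Bs)
classesFrom-MergeSteps {P = P} {seen = seen} (done ⊤∈P) H =
  refl , P , ⊤∈P , subst (History P) (sym (++-identityʳ seen)) H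
classesFrom-MergeSteps {seen = seen} (step {Q = Q} {K} {B} {Bs} s steps) H
  with classesFrom-MergeSteps steps (History-step s H)
... | classes≡ , R , ⊤∈R , H′ =
  trans (cong (λ new → new ++ classesFrom (seen ++ new) K) (newClasses-MergeStep s H)) (cong (B ∷_) classes≡) ,
  R , ⊤∈R , subst (History R) (++-assoc seen [ B ] Bs) H′

module _ {n : ℕ} where

  basisOf : List (Subset n) → Subset n → Bool
  basisOf L X = not (nonTrivial? X) ∨ any (λ C → does (X ≟ˢ C)) L

  private
    basisOf⁻′ : ∀ {X : Subset n} {found} (nt? : Dec (NonTrivial X)) → (not (does nt?) ∨ found) ≡ true →
      ¬ NonTrivial X ⊎ found ≡ true
    basisOf⁻′ (yes _) found = inj₂ found
    basisOf⁻′ (no ¬nt) _ = inj₁ ¬nt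

    basisOf⁺′ : ∀ {X : Subset n} {found} (nt? : Dec (NonTrivial X)) → (NonTrivial X → found ≡ true) →
      (not (does nt?) ∨ found) ≡ true
    basisOf⁺′ (yes nt) found = found nt
    basisOf⁺′ (no _) _ = refl

  basisOf⁻ : ∀ L X → basisOf L X ≡ true → ¬ NonTrivial X ⊎ X ∈ₗ L
  basisOf⁻ L X X∈F with basisOf⁻′ {X = X} (2 ≤? ∣ X ∣) X∈F
  ... | inj₁ ¬nt = inj₁ ¬nt
  ... | inj₂ found = inj₂ (any-≟⇒∈ X L found)

  basisOf-trivial : ∀ L X → ¬ NonTrivial X → basisOf L X ≡ true
  basisOf-trivial L X ¬nt = basisOf⁺′ {X = X} (2 ≤? ∣ X ∣) (λ nt → ⊥-elim (¬nt nt))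

  basisOf-∈ : ∀ L X → X ∈ₗ L → basisOf L X ≡ true
  basisOf-∈ L X X∈L = basisOf⁺′ {X = X} (2 ≤? ∣ X ∣) (λ _ → ∈⇒any-≟ X L X∈L)

  History⇒InΛ : ∀ {R : Partition n} {L} → IsClass R ⊤ → History R L → InΛ L
  History⇒InΛ {R} {L} ⊤∈R H = basisOf L , (independent , maximal) , seen-unique , members , seen-ordered
    where
    open History H
    independent : CDIndependent (basisOf L)
    independent X Y X∈F Y∈F with basisOf⁻ L X X∈F | basisOf⁻ L Y Y∈F
    ... | inj₁ ¬nt | _ = ¬NonTrivial⇒Compatible ¬nt
    ... | inj₂ _ | inj₁ ¬nt = Compatible-sym (¬NonTrivial⇒Compatible ¬nt)
    ... | inj₂ X∈L | inj₂ Y∈L = seen-compatible X Y X∈L Y∈L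
    maximal : ∀ G → CDIndependent G → (∀ X → basisOf L X ≡ true → G X ≡ true) → ∀ X → G X ≡ true → basisOf L X ≡ true
    maximal G independentG F⊆G X X∈G with 2 ≤? ∣ X ∣
    ... | no ¬nt = basisOf-trivial L X ¬nt
    ... | yes nt = basisOf-∈ L X (seen-maximal X nt
          (λ Y Y∈L → independentG X Y X∈G (F⊆G Y (basisOf-∈ L Y Y∈L))) (⊤ , ⊤∈R , ⊆⊤))
    members : ∀ A → (A ∈ₗ L → basisOf L A ≡ true × NonTrivial A) × (basisOf L A ≡ true × NonTrivial A → A ∈ₗ L)
    members A = (λ A∈L → basisOf-∈ L A A∈L , seen-nonTrivial A A∈L) ,
                λ { (A∈F , nt) → [ (λ ¬nt → ⊥-elim (¬nt nt)) , (λ A∈L → A∈L) ]′ (basisOf⁻ L A A∈F) }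

-- Structure of a CD basis

module CDBasis {n : ℕ} {F : Subset (suc n) → Bool} (basis : IsCDBasis F) where

  independent : CDIndependent F
  independent = proj₁ basis

  ∈-basis : ∀ X → (∀ Y → F Y ≡ true → Compatible X Y) → F X ≡ true
  ∈-basis X compatible = proj₂ basis G independentG G-⊇F X G-X
    where
    G : Subset (suc n) → Bool
    G Y = does (Y ≟ˢ X) ∨ F Y
    G⁻ : ∀ Y → G Y ≡ true → Y ≡ X ⊎ F Y ≡ true
    G⁻ Y Y∈G with Y ≟ˢ X
    ... | yes Y≡X = inj₁ Y≡X
    ... | no _ = inj₂ Y∈G
    G-⊇F : ∀ Y → F Y ≡ true → G Y ≡ true
    G-⊇F Y Y∈F with Y ≟ˢ X
    ... | yes _ = refl
    ... | no _ = Y∈F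
    G-X : G X ≡ true
    G-X = cong (_∨ F X) (dec-true (X ≟ˢ X) refl)
    independentG : CDIndependent G
    independentG Y Z Y∈G Z∈G with G⁻ Y Y∈G | G⁻ Z Z∈G
    ... | inj₁ refl | inj₁ refl = inj₁ ⊆-refl
    ... | inj₁ refl | inj₂ Z∈F = compatible Z Z∈F
    ... | inj₂ Y∈F | inj₁ refl = Compatible-sym (compatible Y Y∈F)
    ... | inj₂ Y∈F | inj₂ Z∈F = independent Y Z Y∈F Z∈F

  trivial-∈-basis : ∀ X → ¬ NonTrivial X → F X ≡ true
  trivial-∈-basis X ¬nt = ∈-basis X (λ Y _ → ¬NonTrivial⇒Compatible ¬nt)

  ⊤-∈-basis : F ⊤ ≡ true
  ⊤-∈-basis = ∈-basis ⊤ (λ Y _ → inj₂ (inj₁ ⊆⊤))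

  record Child (B C : Subset (suc n)) : Set where
    field
      C∈F : F C ≡ true
      C⊆B : C ⊆ B
      C≢B : C ≢ B
      C-nonempty : Nonempty C
      C-maximal : ∀ Y → F Y ≡ true → C ⊆ Y → Y ⊆ B → Y ≢ B → Y ≡ C

  childThrough : ∀ {x B} → x ∈ B → NonTrivial B → ∃ λ C → Child B C × x ∈ C
  childThrough {x} {B} x∈B ntB with ⊆-maximal properThrough? {⁅ x ⁆} singleton
    where
    ProperThrough : Subset (suc n) → Set
    ProperThrough Z = F Z ≡ true × x ∈ Z × Z ⊆ B × Z ≢ B
    properThrough? : ∀ Z → Dec (ProperThrough Z)
    properThrough? Z = (F Z ≟ᵇ true) ×-dec ((x ∈? Z) ×-dec ((Z ⊆? B) ×-dec ¬? (Z ≟ˢ B)))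
    singleton : ProperThrough ⁅ x ⁆
    singleton = trivial-∈-basis ⁅ x ⁆ (¬NonTrivial-⁅x⁆ x) , x∈⁅x⁆ x ,
      ¬NonTrivial⇒⊆ (¬NonTrivial-⁅x⁆ x) (x∈⁅x⁆ x) x∈B ,
      λ ⁅x⁆≡B → ¬NonTrivial-⁅x⁆ x (subst NonTrivial (sym ⁅x⁆≡B) ntB)
  ... | C , _ , (C∈F , x∈C , C⊆B , C≢B) , maximalC = C , child , x∈C
    where
    child : Child B C
    child = record
      { C∈F = C∈F ; C⊆B = C⊆B ; C≢B = C≢B ; C-nonempty = x , x∈C
      ; C-maximal = λ Y Y∈F C⊆Y Y⊆B Y≢B → maximalC Y (Y∈F , C⊆Y x∈C , Y⊆B , Y≢B) C⊆Y }

  ∪-children-⊆ : ∀ {B C₁ C₂} → Child B C₁ → Child B C₂ → C₁ ∪ C₂ ⊆ B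
  ∪-children-⊆ {C₁ = C₁} {C₂} child₁ child₂ x∈C₁∪C₂ =
    [ Child.C⊆B child₁ , Child.C⊆B child₂ ]′ (x∈p∪q⁻ C₁ C₂ x∈C₁∪C₂)

  -- A member of F strictly inside B and containing a child equals it, by maximality of the child.
  ∪-children-Compatible : ∀ {B C₁ C₂} → F B ≡ true → Child B C₁ → Child B C₂ →
    ∀ Y → F Y ≡ true → Compatible (C₁ ∪ C₂) Y
  ∪-children-Compatible {B} {C₁} {C₂} B∈F child₁ child₂ Y Y∈F with independent B Y B∈F Y∈F
  ... | inj₁ B⊆Y = inj₁ λ x∈C₁∪C₂ → B⊆Y (∪-children-⊆ child₁ child₂ x∈C₁∪C₂)
  ... | inj₂ (inj₂ empty) = inj₂ (inj₂ (∉⇒Empty∩ λ x∈C₁∪C₂ → Empty∩⇒∉ empty (∪-children-⊆ child₁ child₂ x∈C₁∪C₂)))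
  ... | inj₂ (inj₁ Y⊆B) with Y ≟ˢ B
  ... | yes refl = inj₁ (∪-children-⊆ child₁ child₂)
  ... | no Y≢B with independent C₁ Y (Child.C∈F child₁) Y∈F | independent C₂ Y (Child.C∈F child₂) Y∈F
  ... | inj₁ C₁⊆Y | _ = inj₂ (inj₁ λ y∈Y → p⊆p∪q C₂ (subst (_ ∈_) (Child.C-maximal child₁ Y Y∈F C₁⊆Y Y⊆B Y≢B) y∈Y))
  ... | inj₂ (inj₁ Y⊆C₁) | _ = inj₂ (inj₁ λ y∈Y → p⊆p∪q C₂ (Y⊆C₁ y∈Y))
  ... | _ | inj₁ C₂⊆Y = inj₂ (inj₁ λ y∈Y → q⊆p∪q C₁ C₂ (subst (_ ∈_) (Child.C-maximal child₂ Y Y∈F C₂⊆Y Y⊆B Y≢B) y∈Y))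
  ... | _ | inj₂ (inj₁ Y⊆C₂) = inj₂ (inj₁ λ y∈Y → q⊆p∪q C₁ C₂ (Y⊆C₂ y∈Y))
  ... | inj₂ (inj₂ empty₁) | inj₂ (inj₂ empty₂) = inj₂ (inj₂ (∉⇒Empty∩ λ x∈C₁∪C₂ →
        [ Empty∩⇒∉ empty₁ , Empty∩⇒∉ empty₂ ]′ (x∈p∪q⁻ C₁ C₂ x∈C₁∪C₂)))

  -- Abstract: only the statement is used below, and unfolding the proof there is very expensive.
  abstract
    children : ∀ {B} → F B ≡ true → NonTrivial B →
      ∃₂ λ C₁ C₂ → Child B C₁ × Child B C₂ × Empty (C₁ ∩ C₂) × C₁ ∪ C₂ ≡ B
    children {B} B∈F ntB with NonTrivial⇒distinct B ntB
    ... | x , _ , x∈B , _ with childThrough x∈B ntB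
    ... | C₁ , child₁ , _ with ⊆∧≢⇒∃∉ (Child.C⊆B child₁) (λ B≡C₁ → Child.C≢B child₁ (sym B≡C₁))
    ... | y , y∈B , y∉C₁ with childThrough y∈B ntB
    ... | C₂ , child₂ , y∈C₂ =
      C₁ , C₂ , child₁ , child₂ , C₁∩C₂-empty , ⊆-antisym (∪-children-⊆ child₁ child₂) B⊆C₁∪C₂
      where
      open Child
      C₁∩C₂-empty : Empty (C₁ ∩ C₂)
      C₁∩C₂-empty with independent C₁ C₂ (C∈F child₁) (C∈F child₂)
      ... | inj₁ C₁⊆C₂ = ⊥-elim (y∉C₁
            (subst (y ∈_) (C-maximal child₁ C₂ (C∈F child₂) C₁⊆C₂ (C⊆B child₂) (C≢B child₂)) y∈C₂))
      ... | inj₂ (inj₁ C₂⊆C₁) = ⊥-elim (y∉C₁ (C₂⊆C₁ y∈C₂))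
      ... | inj₂ (inj₂ empty) = empty
      B⊆C₁∪C₂ : B ⊆ C₁ ∪ C₂
      B⊆C₁∪C₂ {z} z∈B with z ∈? (C₁ ∪ C₂)
      ... | yes z∈C₁∪C₂ = z∈C₁∪C₂
      ... | no z∉C₁∪C₂ = ⊥-elim (y∉C₁ (subst (y ∈_) C₁∪C₂≡C₁ (q⊆p∪q C₁ C₂ y∈C₂)))
        where
        C₁∪C₂≡C₁ : C₁ ∪ C₂ ≡ C₁
        C₁∪C₂≡C₁ = C-maximal child₁ (C₁ ∪ C₂) (∈-basis (C₁ ∪ C₂) (∪-children-Compatible B∈F child₁ child₂))
          (p⊆p∪q C₂) (∪-children-⊆ child₁ child₂) (λ C₁∪C₂≡B → z∉C₁∪C₂ (subst (z ∈_) (sym C₁∪C₂≡B) z∈B))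

module _ {a} {A : Set a} where

  Unique-++⇒disjoint : ∀ (pre : List A) {post x} → Unique (pre ++ post) → x ∈ₗ pre → x ∈ₗ post → ⊥
  Unique-++⇒disjoint (p ∷ pre) (p∉ ∷ _) (here refl) x∈post = All.lookup p∉ (∈-++⁺ʳ pre x∈post) refl
  Unique-++⇒disjoint (p ∷ pre) (_ ∷ unique) (there x∈pre) x∈post = Unique-++⇒disjoint pre unique x∈pre x∈post

  ⊑-∷-before : ∀ (pre : List A) {x y post} → Unique (pre ++ y ∷ post) → (x ∷ y ∷ []) ⊑ pre ++ y ∷ post → x ∈ₗ pre
  ⊑-∷-before [] (y∉ ∷ _) (_ ∷ʳ xy⊑) = ⊥-elim (All.lookup y∉ (to∈ (Sublist.∷ˡ⁻ xy⊑)) refl)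
  ⊑-∷-before [] (y∉ ∷ _) (refl ∷ y⊑) = ⊥-elim (All.lookup y∉ (to∈ y⊑) refl)
  ⊑-∷-before (p ∷ pre) (_ ∷ unique) (_ ∷ʳ xy⊑) = there (⊑-∷-before pre unique xy⊑)
  ⊑-∷-before (p ∷ pre) _ (x≡p ∷ _) = here x≡p

  ⊑-∷-after : ∀ (pre : List A) {x y post} → Unique (pre ++ x ∷ post) → (x ∷ y ∷ []) ⊑ pre ++ x ∷ post → y ∈ₗ post
  ⊑-∷-after [] (x∉ ∷ _) (_ ∷ʳ xy⊑) = ⊥-elim (All.lookup x∉ (to∈ xy⊑) refl)
  ⊑-∷-after [] _ (refl ∷ y⊑) = to∈ y⊑
  ⊑-∷-after (p ∷ pre) (_ ∷ unique) (_ ∷ʳ xy⊑) = ⊑-∷-after pre unique xy⊑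
  ⊑-∷-after (p ∷ pre) (p∉ ∷ _) (refl ∷ _) = ⊥-elim (All.lookup p∉ (∈-++⁺ʳ pre (here refl)) refl)

-- Building the maximal chain of a linear extension

module _ {n : ℕ} where

  Available : List (Subset n) → Subset n → Set
  Available pre X = ∣ X ∣ ≡ 1 ⊎ X ∈ₗ pre

  Topmost : List (Subset n) → Subset n → Set
  Topmost pre X = ∀ Y → Y ∈ₗ pre → X ⊆ Y → X ≡ Y

  -- After the sets in pre have been created, the classes are the ⊆-maximal singletons and members of pre.
  record Stage (P : Partition n) (pre : List (Subset n)) : Set where
    field
      class⁻ : ∀ {X} → IsClass P X → Available pre X × Topmost pre X
      class⁺ : ∀ {X} → Available pre X → Topmost pre X → IsClass P X

  Stage-⊥ₚ : Stage ⊥ₚ []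
  Stage-⊥ₚ = record
    { class⁻ = λ {X} X∈⊥ → inj₁ (⊥ₚ-class⁻ {X = X} X∈⊥) , λ Y ()
    ; class⁺ = λ { {X} (inj₁ ∣X∣≡1) _ → ⊥ₚ-class⁺ {X = X} ∣X∣≡1 ; (inj₂ ()) _ }
    }

  Available-narrow : ∀ {pre B X} → Available (pre ++ [ B ]) X → X ≢ B → Available pre X
  Available-narrow (inj₁ ∣X∣≡1) _ = inj₁ ∣X∣≡1
  Available-narrow {pre} (inj₂ X∈) X≢B with ∈-++⁻ pre X∈
  ... | inj₁ X∈pre = inj₂ X∈pre
  ... | inj₂ (here X≡B) = ⊥-elim (X≢B X≡B)

  Stage-MergeStep : ∀ {P Q : Partition n} {pre B} → Stage P pre → MergeStep P Q B →
    (∀ Y → Y ∈ₗ pre → ¬ B ⊆ Y) → Stage Q (pre ++ [ B ])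
  Stage-MergeStep {P} {Q} {pre} {B} stage s B⊈pre = record { class⁻ = class⁻ ; class⁺ = class⁺ }
    where
    B∈new : B ∈ₗ pre ++ [ B ]
    B∈new = ∈-++⁺ʳ pre (here refl)
    B-topmost : Topmost (pre ++ [ B ]) B
    B-topmost Y Y∈ B⊆Y with ∈-++⁻ pre Y∈
    ... | inj₁ Y∈pre = ⊥-elim (B⊈pre Y Y∈pre B⊆Y)
    ... | inj₂ (here refl) = refl
    class⁻ : ∀ {X} → IsClass Q X → Available (pre ++ [ B ]) X × Topmost (pre ++ [ B ]) X
    class⁻ {X} X∈Q with MergeStep.class⁻-disjoint s X∈Q
    ... | inj₁ refl = inj₂ B∈new , B-topmost
    ... | inj₂ (X∈P , X∩B-empty) with Stage.class⁻ stage X∈P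
    ... | available , topmost = map₂ ∈-++⁺ˡ available , topmost′
      where
      topmost′ : Topmost (pre ++ [ B ]) X
      topmost′ Y Y∈ X⊆Y with ∈-++⁻ pre Y∈
      ... | inj₁ Y∈pre = topmost Y Y∈pre X⊆Y
      ... | inj₂ (here refl) = let x , x∈X = nonempty P X X∈P in ⊥-elim (Empty∩⇒∉ X∩B-empty x∈X (X⊆Y x∈X))
    class⁺ : ∀ {X} → Available (pre ++ [ B ]) X → Topmost (pre ++ [ B ]) X → IsClass Q X
    class⁺ {X} available topmost with X ≟ˢ B
    ... | yes X≡B = MergeStep.class⁺-disjoint s (inj₁ X≡B)
    ... | no X≢B = MergeStep.class⁺-disjoint s (inj₂ (X∈P , ∉⇒Empty∩ λ x∈X x∈B →
          X≢B (topmost B B∈new (MergeStep.meets-B⇒⊆B s X∈P x∈X x∈B))))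
      where
      X∈P : IsClass P X
      X∈P = Stage.class⁺ stage (Available-narrow available X≢B) (λ Y Y∈pre → topmost Y (∈-++⁺ˡ Y∈pre))

module FromLinearExtension {n : ℕ} {F : Subset (suc n) → Bool} (basis : IsCDBasis F)
                           {L : List (Subset (suc n))} (extension : IsLinearExtension F L) where

  open CDBasis basis
  open Child

  private
    L-unique : Unique L
    L-unique = proj₁ extension

    L⇒F : ∀ {A} → A ∈ₗ L → F A ≡ true × NonTrivial A
    L⇒F {A} = proj₁ (proj₁ (proj₂ extension) A)

    F⇒L : ∀ {A} → F A ≡ true → NonTrivial A → A ∈ₗ L
    F⇒L {A} A∈F nt = proj₂ (proj₁ (proj₂ extension) A) (A∈F , nt)

    L-ordered : ∀ A B → A ∈ₗ L → B ∈ₗ L → A ⊆ B → A ≢ B → (A ∷ B ∷ []) ⊑ L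
    L-ordered = proj₂ (proj₂ extension)

  module _ (pre : List (Subset (suc n))) {B post} (L≡ : pre ++ B ∷ post ≡ L) where

    private
      unique : Unique (pre ++ B ∷ post)
      unique = subst Unique (sym L≡) L-unique

      ordered : ∀ {A C} → A ∈ₗ L → C ∈ₗ L → A ⊆ C → A ≢ C → (A ∷ C ∷ []) ⊑ pre ++ B ∷ post
      ordered A∈L C∈L A⊆C A≢C = subst (_ ⊑_) (sym L≡) (L-ordered _ _ A∈L C∈L A⊆C A≢C)

      pre⇒L : ∀ {Y} → Y ∈ₗ pre → Y ∈ₗ L
      pre⇒L {Y} Y∈pre = subst (Y ∈ₗ_) L≡ (∈-++⁺ˡ Y∈pre)

      B∈L : B ∈ₗ L
      B∈L = subst (B ∈ₗ_) L≡ (∈-++⁺ʳ pre (here refl))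

    B⊈pre : ∀ Y → Y ∈ₗ pre → ¬ B ⊆ Y
    B⊈pre Y Y∈pre B⊆Y with Y ≟ˢ B
    ... | yes refl = Unique-++⇒disjoint pre unique Y∈pre (here refl)
    ... | no Y≢B = Unique-++⇒disjoint pre unique Y∈pre
          (there (⊑-∷-after pre unique (ordered B∈L (pre⇒L Y∈pre) B⊆Y (λ B≡Y → Y≢B (sym B≡Y)))))

    child-available : ∀ {C} → Child B C → Available pre C
    child-available child with Nonempty⇒∣p∣≡1⊎NonTrivial (C-nonempty child)
    ... | inj₁ ∣C∣≡1 = inj₁ ∣C∣≡1
    ... | inj₂ nt = inj₂ (⊑-∷-before pre unique
          (ordered (F⇒L (C∈F child) nt) B∈L (C⊆B child) (C≢B child)))

    child-topmost : ∀ {C} → Child B C → Topmost pre C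
    child-topmost child Y Y∈pre C⊆Y with independent B Y (proj₁ (L⇒F B∈L)) (proj₁ (L⇒F (pre⇒L Y∈pre)))
    ... | inj₁ B⊆Y = ⊥-elim (B⊈pre Y Y∈pre B⊆Y)
    ... | inj₂ (inj₂ empty) = let z , z∈C = C-nonempty child in
          ⊥-elim (Empty∩⇒∉ empty (C⊆B child z∈C) (C⊆Y z∈C))
    ... | inj₂ (inj₁ Y⊆B) with Y ≟ˢ B
    ...   | yes refl = ⊥-elim (B⊈pre Y Y∈pre ⊆-refl)
    ...   | no Y≢B = sym (C-maximal child Y (proj₁ (L⇒F (pre⇒L Y∈pre))) C⊆Y Y⊆B Y≢B)

    -- The two children of B are classes of the current stage; merging them creates B.
    Stage-next : ∀ {P} → Stage P pre → ∃ λ Q → MergeStep P Q B × Stage Q (pre ++ [ B ])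
    Stage-next {P} stage with children (proj₁ (L⇒F B∈L)) (proj₂ (L⇒F B∈L))
    ... | C₁ , C₂ , child₁ , child₂ , C₁∩C₂-empty , C₁∪C₂≡B = Q , s , Stage-MergeStep stage s B⊈pre
      where
      C₁∈P : IsClass P C₁
      C₁∈P = Stage.class⁺ stage (child-available child₁) (child-topmost child₁)
      C₂∈P : IsClass P C₂
      C₂∈P = Stage.class⁺ stage (child-available child₂) (child-topmost child₂)
      C₁≢C₂ : C₁ ≢ C₂
      C₁≢C₂ refl = let x , x∈C₁ = C-nonempty child₁ in Empty∩⇒∉ C₁∩C₂-empty x∈C₁ x∈C₁
      Q : Partition (suc n)
      Q = Merge.merge P C₁∈P C₂∈P
      s : MergeStep P Q B
      s = subst (MergeStep P Q) C₁∪C₂≡B (merge-MergeStep C₁∈P C₂∈P C₁≢C₂)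

  build : ∀ pre post → pre ++ post ≡ L → ∀ {P} → Stage P pre → ∃ λ K → MergeSteps P K post
  build pre [] L≡ stage = [] , done (Stage.class⁺ stage ⊤-available (λ Y _ ⊤⊆Y → ⊆-antisym ⊤⊆Y ⊆⊤))
    where
    ⊤-available : Available pre ⊤
    ⊤-available with Nonempty⇒∣p∣≡1⊎NonTrivial {p = ⊤ {suc n}} (zero , ∈⊤)
    ... | inj₁ ∣⊤∣≡1 = inj₁ ∣⊤∣≡1
    ... | inj₂ nt = inj₂ (subst (⊤ ∈ₗ_) (trans (sym L≡) (++-identityʳ pre)) (F⇒L ⊤-∈-basis nt))
  build pre (B ∷ post) L≡ stage with Stage-next pre L≡ stage
  ... | Q , s , stage′ with build (pre ++ [ B ]) post (trans (++-assoc pre [ B ] post) L≡) stage′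
  ... | K , steps = Q ∷ K , step s steps

  surjective : ∃ λ K → IsMaximalChain K × chainClasses K ≡ L
  surjective with build [] L refl Stage-⊥ₚ
  ... | K , steps = ⊥ₚ ∷ K , MergeSteps⇒maximalChain steps ,
        proj₁ (classesFrom-MergeSteps steps (History-start (≤ₚ-refl {P = ⊥ₚ})))

module _ {n : ℕ} where

  maximalChain-steps : ∀ {Π₀ : Partition (suc n)} {K₁} → IsMaximalChain (Π₀ ∷ K₁) →
    Π₀ ≤ₚ ⊥ₚ × MergeSteps Π₀ K₁ (chainClasses (Π₀ ∷ K₁))
  maximalChain-steps maximal with maximalChain⇒MergeSteps maximal
  ... | Π₀≤⊥ₚ , _ , steps =
    Π₀≤⊥ₚ , subst (MergeSteps _ _) (sym (proj₁ (classesFrom-MergeSteps steps (History-start Π₀≤⊥ₚ)))) steps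

  chainClasses-InΛ : ∀ K → IsMaximalChain K → InΛ (chainClasses K)
  chainClasses-InΛ [] maximal = ⊥-elim (maximalChain-nonempty maximal)
  chainClasses-InΛ (Π₀ ∷ K₁) maximal with maximalChain-steps maximal
  ... | Π₀≤⊥ₚ , steps with classesFrom-MergeSteps steps (History-start Π₀≤⊥ₚ)
  ... | _ , R , ⊤∈R , history = History⇒InΛ ⊤∈R history

  chainClasses-injective : ∀ K K′ → IsMaximalChain K → IsMaximalChain K′ →
    chainClasses K ≡ chainClasses K′ → Pointwise _≈ₚ_ K K′
  chainClasses-injective [] _ maximal _ _ = ⊥-elim (maximalChain-nonempty maximal)
  chainClasses-injective (_ ∷ _) [] _ maximal′ _ = ⊥-elim (maximalChain-nonempty maximal′)
  chainClasses-injective (Π₀ ∷ K₁) (Π₀′ ∷ K₁′) maximal maximal′ classes≡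
    with maximalChain-steps maximal | maximalChain-steps maximal′
  ... | Π₀≤⊥ₚ , steps | Π₀′≤⊥ₚ , steps′ =
    Π₀≈Π₀′ ∷ MergeSteps-injective steps (subst (MergeSteps Π₀′ K₁′) (sym classes≡) steps′) Π₀≈Π₀′
    where
    Π₀≈Π₀′ : Π₀ ≈ₚ Π₀′
    Π₀≈Π₀′ = ≤ₚ-antisym {P = Π₀} {Π₀′} (≤ₚ-trans {P = Π₀} {⊥ₚ} {Π₀′} Π₀≤⊥ₚ (⊥ₚ-minimum Π₀′))
                                       (≤ₚ-trans {P = Π₀′} {⊥ₚ} {Π₀} Π₀′≤⊥ₚ (⊥ₚ-minimum Π₀))

  chainClasses-surjective : ∀ L → InΛ L → ∃ λ K → IsMaximalChain K × chainClasses K ≡ L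
  chainClasses-surjective L (F , basis , extension) = FromLinearExtension.surjective {n} basis extension

mainTheorem1 : (n : ℕ) →
    (∀ (K : List (Partition (suc n))) → IsMaximalChain K → InΛ (chainClasses K))
    × (∀ (K K′ : List (Partition (suc n))) → IsMaximalChain K → IsMaximalChain K′ →
         chainClasses K ≡ chainClasses K′ → Pointwise _≈ₚ_ K K′)
    × (∀ (L : List (Subset (suc n))) → InΛ L →
         ∃ λ (K : List (Partition (suc n))) → IsMaximalChain K × chainClasses K ≡ L)
mainTheorem1 n = chainClasses-InΛ , chainClasses-injective , chainClasses-surjective {n}
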